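{- Let $b$ be a Baer subline of $\ell_\infty$ in $\mathrm{PG}(2,q^2)$, and let $\bar P,\bar Q\in\ell_\infty$ be conjugate with respect to $b$. Then in $\mathrm{PG}(4,q^2)$, the lines $PQ^q$ and $P^qQ$ are lines of the extended regulus $[b]^\star$.
   Context: Bruck–Bose setting: $q$ is a prime power; $\Sigma_\infty$ is a hyperplane of $\mathrm{PG}(4,q)$ and $\mathcal S$ a regular spread of $\Sigma_\infty$; the points $\bar T$ of $\ell_\infty$ in $\mathrm{PG}(2,q^2)$ correspond bijectively to the lines $[T]$ of $\mathcal S$ (affine points of $\mathrm{PG}(2,q^2)$ corresponding to points of $\mathrm{PG}(4,q)\setminus\Sigma_\infty$, lines other than $\ell_\infty$ to planes not in $\Sigma_\infty$ containing a spread line). A Baer subline $b$ of $\ell_\infty$ corresponds to a regulus $[b]$ of $q+1$ spread lines; $[b]^\star$ denotes the regulus of $\mathrm{PG}(4,q^2)$ consisting of the $q^2+1$ lines of the extended hyperbolic quadric in the same ruling, containing the extensions of the lines of $[b]$. For $X\in\mathrm{PG}(4,q^2)$, $X^q$ has all coordinates raised to the $q$-th power. In $\mathrm{PG}(4,q^2)$ the transversals of $\mathcal S$ are the unique conjugate lines $g,g^q$ such that the extension of each spread line $[T]$ is $TT^q$ with $T=[T]^\star\cap g$; for $\bar P\in\ell_\infty$, $P$ denotes the point $[P]^\star\cap g$. Two points of $\ell_\infty$ are conjugate with respect to the Baer subline $b$ if they are interchanged by the unique involutory collineation of $\ell_\infty$ fixing $b$ pointwise. -}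

module Defs where

open import Data.Nat using (ℕ; zero; suc)
open import Data.Fin using (Fin) renaming (zero to f0; suc to fs)
open import Data.Product using (Σ; _×_; _,_)
open import Relation.Binary.PropositionalEquality using (_≡_; _≢_)
open import Relation.Nullary using (¬_)
open import Algebra.Structures using (IsCommutativeRing)
open import Function.Bundles using (_↔_; _⇔_)

record FiniteField : Set₁ where
  infixl 7 _*_
  infixl 6 _+_
  field
    Carrier           : Set
    _+_ _*_           : Carrier → Carrier → Carrier
    -_                : Carrier → Carrier
    0# 1#             : Carrier
    isCommutativeRing : IsCommutativeRing _≡_ _+_ _*_ -_ 0# 1#
    0≢1               : 0# ≢ 1#
    inverse           : ∀ x → x ≢ 0# → Σ Carrier (λ y → x * y ≡ 1#)
    order             : ℕ
    enumeration       : Carrier ↔ Fin order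

-- Geometry over K = GF(q^2) (the theorem assumes order K ≡ q * q).
module Geom (K : FiniteField) (q : ℕ) where
  open FiniteField K public

  F : Set
  F = Carrier

  infixr 8 _^_
  _^_ : F → ℕ → F
  x ^ zero  = 1#
  x ^ suc n = x * (x ^ n)

  -- Frobenius x ↦ x^q; its fixed field is GF(q)
  frob : F → F
  frob x = x ^ q

  InGFq : F → Set
  InGFq x = frob x ≡ x

  -- PG(4,q^2): homogeneous coordinates (x0,...,x4)
  V5 : Set
  V5 = Fin 5 → F

  NonZero5 : V5 → Set
  NonZero5 v = Σ (Fin 5) (λ i → v i ≢ 0#)

  Same5 : V5 → V5 → Set
  Same5 u v = Σ F (λ l → l ≢ 0# × (∀ i → u i ≡ l * v i))

  conj : V5 → V5
  conj v i = frob (v i)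

  InSpan : V5 → V5 → V5 → Set
  InSpan X A B = Σ F (λ c → Σ F (λ d → ∀ i → X i ≡ c * A i + d * B i))

  Independent : V5 → V5 → Set
  Independent A B = ∀ c d → (∀ i → c * A i + d * B i ≡ 0#) → (c ≡ 0#) × (d ≡ 0#)

  record Line : Set where
    constructor line
    field
      pt₁ pt₂ : V5
      indep   : Independent pt₁ pt₂

  OnLine : V5 → Line → Set
  OnLine X L = NonZero5 X × InSpan X (Line.pt₁ L) (Line.pt₂ L)

  Meet : Line → Line → Set
  Meet L M = Σ V5 (λ X → OnLine X L × OnLine X M)

  -- ℓ∞ of PG(2,q^2): points (x,y,0), stored as (x,y)
  V2 : Set
  V2 = F × F

  NonZero2 : V2 → Set
  NonZero2 (x , y) = ¬ ((x ≡ 0#) × (y ≡ 0#))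

  Same2 : V2 → V2 → Set
  Same2 (x , y) (x' , y') = Σ F (λ l → l ≢ 0# × (x ≡ l * x') × (y ≡ l * y'))

  -- Baer subline of ℓ∞: points αu+βw, (α,β) ∈ GF(q)^2∖{0}, with u,w independent
  record BaerSubline : Set where
    field
      u w  : V2
      det≢0 : Σ.proj₁ u * Σ.proj₂ w + - (Σ.proj₂ u * Σ.proj₁ w) ≢ 0#

  InBaer : BaerSubline → V2 → Set
  InBaer b p =
    Σ F (λ α → Σ F (λ β → InGFq α × InGFq β × ¬ ((α ≡ 0#) × (β ≡ 0#)) ×
      Same2 p ((α * Σ.proj₁ u + β * Σ.proj₁ w) , (α * Σ.proj₂ u + β * Σ.proj₂ w))))
    where open BaerSubline b

  -- Collineations of ℓ∞ = PG(1,q^2): induced by nonsingular semilinear maps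
  record Collineation : Set where
    field
      θ       : F → F
      θ-+     : ∀ x y → θ (x + y) ≡ θ x + θ y
      θ-*     : ∀ x y → θ (x * y) ≡ θ x * θ y
      θ-1     : θ 1# ≡ 1#
      θ-surj  : ∀ y → Σ F (λ x → θ x ≡ y)
      σ       : V2 → V2
      σ-+     : ∀ x y x' y' → σ ((x + x') , (y + y'))
                  ≡ ((Σ.proj₁ (σ (x , y)) + Σ.proj₁ (σ (x' , y'))) ,
                     (Σ.proj₂ (σ (x , y)) + Σ.proj₂ (σ (x' , y'))))
      σ-semi  : ∀ l x y → σ ((l * x) , (l * y))
                  ≡ ((θ l * Σ.proj₁ (σ (x , y))) , (θ l * Σ.proj₂ (σ (x , y))))
      σ-nonsing : ∀ v → NonZero2 v → NonZero2 (σ v)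

  -- involutory (of order exactly 2 on the points of ℓ∞) and fixing b pointwise
  IsBaerInvolution : BaerSubline → Collineation → Set
  IsBaerInvolution b c =
    (∀ v → NonZero2 v → Same2 (σ (σ v)) v) ×
    Σ V2 (λ v → NonZero2 v × ¬ Same2 (σ v) v) ×
    (∀ p → NonZero2 p → InBaer b p → Same2 (σ p) p)
    where open Collineation c

  -- P̄, Q̄ conjugate w.r.t. b: interchanged by the involutory collineation fixing b
  Conjugate : BaerSubline → V2 → V2 → Set
  Conjugate b P Q = Σ Collineation (λ c → IsBaerInvolution b c ×
    Same2 (Collineation.σ c P) Q × Same2 (Collineation.σ c Q) P)

  -- Bruck–Bose: Σ∞ is x4 = 0, τ ∈ GF(q^2)∖GF(q).  The spread line [T] of
  -- T̄ = (x,y,0) consists of the GF(q)-vectors (a0,a1,b0,b1,0) with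
  -- (a0 + a1 τ , b0 + b1 τ) ∈ GF(q^2)·(x,y).
  c0 c1 c2 c3 c4 : Fin 5
  c0 = f0
  c1 = fs f0
  c2 = fs (fs f0)
  c3 = fs (fs (fs f0))
  c4 = fs (fs (fs (fs f0)))

  SpreadVec : F → V2 → V5 → Set
  SpreadVec τ (x , y) u = (∀ i → InGFq (u i)) × (u c4 ≡ 0#) ×
    Σ F (λ l → (u c0 + u c1 * τ ≡ l * x) × (u c2 + u c3 * τ ≡ l * y))

  -- X is a point of the extension [T]^★ (in PG(4,q^2)) of the spread line [T]
  InExtSpread : F → V2 → V5 → Set
  InExtSpread τ T X = NonZero5 X ×
    Σ V5 (λ u → Σ V5 (λ w → SpreadVec τ T u × SpreadVec τ T w × InSpan X u w))

  IsTransversal : F → Line → Set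
  IsTransversal τ g = ∀ T → NonZero2 T →
    Σ V5 (λ P → OnLine P g × InExtSpread τ T P ×
      (∀ P' → OnLine P' g → InExtSpread τ T P' → Same5 P' P) ×
      (∀ X → NonZero5 X → (InExtSpread τ T X ⇔ InSpan X P (conj P))))

  -- lines of PG(4,q^2) meeting [T]^★ for every T̄ ∈ b: the opposite ruling of
  -- the extended hyperbolic quadric of [b]
  InOppExtRegulus : F → BaerSubline → Line → Set
  InOppExtRegulus τ b m = ∀ T → NonZero2 T → InBaer b T →
    Σ V5 (λ X → OnLine X m × InExtSpread τ T X)

  -- the line AB is a line of [b]^★: it is a line (A,B independent) meeting every
  -- line of the opposite ruling
  InExtRegulus : F → BaerSubline → V5 → V5 → Set
  InExtRegulus τ b A B = Σ (Independent A B) (λ ind →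
    ∀ m → InOppExtRegulus τ b m → Meet (line A B ind) m)

{-# OPTIONS --safe #-}
-- Write φ t X = (X₀ + X₁ t , X₂ + X₃ t) and τ′ = τ ^ q.  A point X of Σ∞ lies on [T]^★ iff
-- φ τ X ∝ T and φ τ′ X ∝ T^q, and the transversal g is the kernel of φ τ′ or of φ τ.  The
-- collineation of ℓ∞ fixing b pointwise has companion automorphism x ↦ x ^ q (an involution of
-- GF(q²), other than the identity, fixing GF(q)), so in a basis u, w of b the conjugate points
-- are P̄ = α u + β w and Q̄ ∝ α^q u + β^q w.  If g = ker (φ τ′), then φ τ P ∝ α u + β w,
-- φ τ′ P = 0, φ τ Q^q = 0 and φ τ′ Q^q ∝ α u^q + β w^q.  A line m of the opposite ruling meets
-- [u]^★ and [w]^★ in Xᵤ and Xʷ and [u + w]^★ in x Xᵤ + y Xʷ; the point α x Xᵤ + β y Xʷ of m then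
-- has the φ-coordinates of a point of P Q^q, so m meets P Q^q.  The case g = ker (φ τ) follows
-- by applying conj.
module Submission where

open import Defs
open import Algebra.Bundles using (CommutativeRing)
open import Data.Empty using (⊥-elim)
open import Data.Fin.Base using (Fin) renaming (zero to f0; suc to fs)
import Data.Fin.Properties as Fin
import Data.Integer.Base as ℤ
open import Data.List.Base using (List; []; _∷_; map; length; filter; allFin; cartesianProductWith)
open import Data.List.Properties using (length-++; length-map; length-tabulate)
open import Data.List.Membership.Propositional using (_∈_)
open import Data.List.Membership.Propositional.Properties
  using (∈-map⁺; ∈-map⁻; ∈-allFin; ∈-filter⁺; ∈-filter⁻; ∈-cartesianProductWith⁺; ∈-cartesianProductWith⁻)
open import Data.List.Membership.Propositional.Properties.WithK using (unique∧set⇒bag)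
open import Data.List.Relation.Binary.BagAndSetEquality using (∼bag⇒↭)
open import Data.List.Relation.Binary.Disjoint.Propositional using (Disjoint)
open import Data.List.Relation.Binary.Permutation.Propositional as Perm using (_↭_)
open import Data.List.Relation.Binary.Permutation.Propositional.Properties using (↭-length)
open import Data.List.Relation.Unary.All using (All; []; _∷_; lookup)
import Data.List.Relation.Unary.All as All
open import Data.List.Relation.Unary.AllPairs using ([]; _∷_)
open import Data.List.Relation.Unary.Any using (here; there)
open import Data.List.Relation.Unary.Unique.Propositional using (Unique)
open import Data.List.Relation.Unary.Unique.Propositional.Properties using (++⁺; allFin⁺; filter⁺)
open import Data.Nat.Base as ℕ using (ℕ; zero; suc; _≤_; s≤s)
import Data.Nat.Properties as ℕ
open import Data.Product.Base using (Σ-syntax; _×_; _,_; proj₁; proj₂; swap)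
open import Data.Product.Properties using (×-≡,≡→≡)
open import Data.Sum.Base using (_⊎_; inj₁; inj₂; [_,_]′)
open import Data.Vec.Base using (Vec; []; _∷_)
open import Function.Bundles using (Inverse; Injection; mk⇔)
open import Function.Properties.Inverse using (Inverse⇒Injection; ↔-sym)
open import Relation.Binary.Definitions using (DecidableEquality; tri<; tri≈; tri>)
open import Relation.Binary.PropositionalEquality as ≡
  using (_≡_; _≢_; refl; sym; cong; cong₂; subst; module ≡-Reasoning)
open import Relation.Nullary using (¬_; Dec; yes; no; ¬?)
open import Relation.Nullary.Decidable using (_×-dec_; map′)

-- Algebra.Solver.Ring with integer coefficients: unlike elements of an abstract ring,
-- these can be compared by evaluation when normal forms are checked.
module IntegerRingSolver {c ℓ} (R : CommutativeRing c ℓ) where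
  open import Data.Integer.Base as ℤ using (ℤ; +_; -[1+_]; _⊖_)
  import Data.Integer.Properties as ℤ
  open import Data.Sign.Base as Sign using (Sign)
  open import Data.Maybe.Base using (Maybe; just; nothing)
  import Algebra.Solver.Ring.AlmostCommutativeRing as ACR
  open CommutativeRing R renaming (refl to ≈-refl; sym to ≈-sym; trans to ≈-trans)
  open import Algebra.Properties.Ring ring using (-‿distribˡ-*; -‿distribʳ-*; -‿involutive; -0#≈0#; -‿+-comm)
  open import Algebra.Properties.Semiring.Mult.TCOptimised semiring using (1+×; ×-homo-+; ×1-homo-*) renaming (_×_ to _·_)
  open import Relation.Binary.Reasoning.Setoid setoid

  fromℤ : ℤ → Carrier
  fromℤ (+ n)    = n · 1#
  fromℤ -[1+ n ] = - (suc n · 1#)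

  signed : Sign → Carrier → Carrier
  signed Sign.+ x = x
  signed Sign.- x = - x

  private
    x+y-[x+z]≈y-z : ∀ x y z → (x + y) + - (x + z) ≈ y + - z
    x+y-[x+z]≈y-z x y z = begin
      (x + y) + - (x + z)     ≈⟨ +-congˡ (-‿+-comm x z) ⟨
      (x + y) + (- x + - z)   ≈⟨ +-assoc x y _ ⟩
      x + (y + (- x + - z))   ≈⟨ +-congˡ (+-assoc y (- x) (- z)) ⟨
      x + ((y + - x) + - z)   ≈⟨ +-congˡ (+-congʳ (+-comm y (- x))) ⟩
      x + ((- x + y) + - z)   ≈⟨ +-congˡ (+-assoc (- x) y (- z)) ⟩
      x + (- x + (y + - z))   ≈⟨ +-assoc x (- x) _ ⟨
      (x + - x) + (y + - z)   ≈⟨ +-congʳ (-‿inverseʳ x) ⟩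
      0# + (y + - z)          ≈⟨ +-identityˡ _ ⟩
      y + - z                 ∎

  ⊖-homo : ∀ m n → fromℤ (m ⊖ n) ≈ m · 1# + - (n · 1#)
  ⊖-homo zero    zero    = ≈-sym (≈-trans (+-congˡ -0#≈0#) (+-identityʳ 0#))
  ⊖-homo zero    (suc n) = ≈-sym (+-identityˡ _)
  ⊖-homo (suc m) zero    = ≈-sym (≈-trans (+-congˡ -0#≈0#) (+-identityʳ _))
  ⊖-homo (suc m) (suc n) = begin
    fromℤ (suc m ⊖ suc n)             ≡⟨ ≡.cong fromℤ (ℤ.[1+m]⊖[1+n]≡m⊖n m n) ⟩
    fromℤ (m ⊖ n)                     ≈⟨ ⊖-homo m n ⟩
    m · 1# + - (n · 1#)               ≈⟨ x+y-[x+z]≈y-z 1# _ _ ⟨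
    (1# + m · 1#) + - (1# + n · 1#)   ≈⟨ +-cong (1+× m 1#) (-‿cong (1+× n 1#)) ⟨
    suc m · 1# + - (suc n · 1#)       ∎

  ◃-homo : ∀ s n → fromℤ (s ℤ.◃ n) ≈ signed s (n · 1#)
  ◃-homo Sign.+ zero    = ≈-refl
  ◃-homo Sign.- zero    = ≈-sym -0#≈0#
  ◃-homo Sign.+ (suc n) = ≈-refl
  ◃-homo Sign.- (suc n) = ≈-refl

  signed-sign-abs : ∀ i → fromℤ i ≈ signed (ℤ.sign i) (ℤ.∣ i ∣ · 1#)
  signed-sign-abs (+ n)    = ≈-refl
  signed-sign-abs -[1+ n ] = ≈-refl

  signed-* : ∀ s t x y → signed (s Sign.* t) (x * y) ≈ signed s x * signed t y
  signed-* Sign.+ Sign.+ x y = ≈-refl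
  signed-* Sign.+ Sign.- x y = -‿distribʳ-* x y
  signed-* Sign.- Sign.+ x y = -‿distribˡ-* x y
  signed-* Sign.- Sign.- x y = begin
    x * y           ≈⟨ -‿involutive _ ⟨
    - - (x * y)     ≈⟨ -‿cong (-‿distribˡ-* x y) ⟩
    - (- x * y)     ≈⟨ -‿distribʳ-* (- x) y ⟩
    - x * - y       ∎

  +-homo : ∀ i j → fromℤ (i ℤ.+ j) ≈ fromℤ i + fromℤ j
  +-homo (+ m)    (+ n)    = ×-homo-+ 1# m n
  +-homo (+ m)    -[1+ n ] = ⊖-homo m (suc n)
  +-homo -[1+ m ] (+ n)    = ≈-trans (⊖-homo n (suc m)) (+-comm _ _)
  +-homo -[1+ m ] -[1+ n ] = begin
    - (suc (suc (m ℕ.+ n)) · 1#)         ≡⟨ ≡.cong (λ k → - (suc k · 1#)) (≡.sym (ℕ.+-suc m n)) ⟩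
    - ((suc m ℕ.+ suc n) · 1#)           ≈⟨ -‿cong (×-homo-+ 1# (suc m) (suc n)) ⟩
    - (suc m · 1# + suc n · 1#)          ≈⟨ -‿+-comm _ _ ⟨
    - (suc m · 1#) + - (suc n · 1#)      ∎

  *-homo : ∀ i j → fromℤ (i ℤ.* j) ≈ fromℤ i * fromℤ j
  *-homo i j = begin
    fromℤ (s ℤ.◃ (ℤ.∣ i ∣ ℕ.* ℤ.∣ j ∣))                                  ≈⟨ ◃-homo s (ℤ.∣ i ∣ ℕ.* ℤ.∣ j ∣) ⟩
    signed s ((ℤ.∣ i ∣ ℕ.* ℤ.∣ j ∣) · 1#)                                ≈⟨ signed-cong s (×1-homo-* ℤ.∣ i ∣ ℤ.∣ j ∣) ⟩
    signed s ((ℤ.∣ i ∣ · 1#) * (ℤ.∣ j ∣ · 1#))                           ≈⟨ signed-* (ℤ.sign i) (ℤ.sign j) _ _ ⟩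
    signed (ℤ.sign i) (ℤ.∣ i ∣ · 1#) * signed (ℤ.sign j) (ℤ.∣ j ∣ · 1#) ≈⟨ *-cong (signed-sign-abs i) (signed-sign-abs j) ⟨
    fromℤ i * fromℤ j                                                   ∎
    where
    s : Sign
    s = ℤ.sign i Sign.* ℤ.sign j
    signed-cong : ∀ s {x y} → x ≈ y → signed s x ≈ signed s y
    signed-cong Sign.+ x≈y = x≈y
    signed-cong Sign.- x≈y = -‿cong x≈y

  -‿homo : ∀ i → fromℤ (ℤ.- i) ≈ - fromℤ i
  -‿homo (+ zero)    = ≈-sym -0#≈0#
  -‿homo (+ suc n)   = ≈-refl
  -‿homo -[1+ n ]    = ≈-sym (-‿involutive _)

  homomorphism : ACR._-Raw-AlmostCommutative⟶_ ℤ.+-*-rawRing (ACR.fromCommutativeRing R)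
  homomorphism = record
    { ⟦_⟧    = fromℤ
    ; +-homo = +-homo
    ; *-homo = *-homo
    ; -‿homo = -‿homo
    ; 0-homo = ≈-refl
    ; 1-homo = ≈-refl
    }

  equal? : ∀ i j → Maybe (fromℤ i ≈ fromℤ j)
  equal? i j with i ℤ.≟ j
  ... | yes ≡.refl = just ≈-refl
  ... | no _       = nothing

  open import Algebra.Solver.Ring ℤ.+-*-rawRing (ACR.fromCommutativeRing R) homomorphism equal? public
    using (solve; _:+_; _:*_; :-_; _:-_; _:=_; con)

  m*m≡n*n⇒m≡n : ∀ {m n} → m ℕ.* m ≡ n ℕ.* n → m ≡ n
  m*m≡n*n⇒m≡n {m} {n} e with ℕ.<-cmp m n
  ... | tri< m<n _ _ = ⊥-elim (ℕ.<-irrefl e (ℕ.*-mono-< m<n m<n))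
  ... | tri≈ _ m≡n _ = m≡n
  ... | tri> _ _ n<m = ⊥-elim (ℕ.<-irrefl (sym e) (ℕ.*-mono-< n<m n<m))

module _ {A B : Set} (f : A → B) where

  Unique-map⁺ : ∀ {xs} → (∀ {x y} → x ∈ xs → y ∈ xs → f x ≡ f y → x ≡ y) →
                Unique xs → Unique (map f xs)
  Unique-map⁺ {[]}     inj []         = []
  Unique-map⁺ {x ∷ xs} inj (x∉ ∷ xs!) =
    distinct x∉ (λ y∈ → inj (here refl) (there y∈)) ∷ Unique-map⁺ (λ x∈ y∈ → inj (there x∈) (there y∈)) xs!
    where
    distinct : ∀ {ys} → All (x ≢_) ys → (∀ {y} → y ∈ ys → f x ≡ f y → x ≡ y) → All (f x ≢_) (map f ys)
    distinct []         inj′ = []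
    distinct (x≢y ∷ ps) inj′ = (λ e → x≢y (inj′ (here refl) e)) ∷ distinct ps (λ y∈ → inj′ (there y∈))

module _ {A B C : Set} (f : A → B → C) where

  length-cartesianProductWith : ∀ xs ys → length (cartesianProductWith f xs ys) ≡ length xs ℕ.* length ys
  length-cartesianProductWith []       ys = refl
  length-cartesianProductWith (x ∷ xs) ys =
    ≡.trans (length-++ (map (f x) ys)) (cong₂ ℕ._+_ (length-map (f x) ys) (length-cartesianProductWith xs ys))

  Unique-cartesianProductWith⁺ : ∀ {xs ys} →
    (∀ {a b c d} → a ∈ xs → b ∈ ys → c ∈ xs → d ∈ ys → f a b ≡ f c d → a ≡ c × b ≡ d) →
    Unique xs → Unique ys → Unique (cartesianProductWith f xs ys)
  Unique-cartesianProductWith⁺ {[]}     inj []         ys! = []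
  Unique-cartesianProductWith⁺ {x ∷ xs} {ys} inj (x∉ ∷ xs!) ys! = ++⁺
    (Unique-map⁺ (f x) (λ b∈ d∈ e → proj₂ (inj (here refl) b∈ (here refl) d∈ e)) ys!)
    (Unique-cartesianProductWith⁺ (λ a∈ b∈ c∈ d∈ → inj (there a∈) b∈ (there c∈) d∈) xs! ys!)
    disjoint
    where
    disjoint : Disjoint (map (f x) ys) (cartesianProductWith f xs ys)
    disjoint (z∈₁ , z∈₂) with ∈-map⁻ (f x) z∈₁ | ∈-cartesianProductWith⁻ f xs ys z∈₂
    ... | b , b∈ , refl | a , b′ , a∈ , b′∈ , e = lookup x∉ a∈ (proj₁ (inj (here refl) b∈ (there a∈) b′∈ e))

module _ {A : Set} where

  unique-same-elements⇒↭ : ∀ {xs ys : List A} → Unique xs → Unique ys →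
    (∀ {x} → x ∈ xs → x ∈ ys) → (∀ {x} → x ∈ ys → x ∈ xs) → xs ↭ ys
  unique-same-elements⇒↭ xs! ys! ⊆ ⊇ = ∼bag⇒↭ (unique∧set⇒bag xs! ys! (mk⇔ ⊆ ⊇))

module _ (K : FiniteField) (q : ℕ) where
  open Geom K q

  -- Arithmetic in GF(q²)

  commutativeRing : CommutativeRing _ _
  commutativeRing = record { isCommutativeRing = isCommutativeRing }

  open CommutativeRing commutativeRing
    using (+-assoc; +-comm; *-assoc; *-comm; +-identityˡ; +-identityʳ; *-identityˡ; *-identityʳ;
           -‿inverseʳ; zeroˡ; zeroʳ; ring)
  open import Algebra.Properties.Ring ring
    using (-‿involutive; -0#≈0#; x∙y⁻¹≈ε⇒x≈y; x≈y⇒x∙y⁻¹≈ε; x+x≈x⇒x≈0; +-inverseʳ-unique)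
  open IntegerRingSolver commutativeRing

  infix 4 _≟_
  _≟_ : DecidableEquality F
  x ≟ y = map′ (Injection.injective (Inverse⇒Injection enumeration)) (cong (Inverse.to enumeration))
                (Inverse.to enumeration x Fin.≟ Inverse.to enumeration y)

  1≢0 : 1# ≢ 0#
  1≢0 e = 0≢1 (sym e)

  inv : (x : F) → x ≢ 0# → F
  inv x x≢0 = proj₁ (inverse x x≢0)

  x*inv≡1 : ∀ x (x≢0 : x ≢ 0#) → x * inv x x≢0 ≡ 1#
  x*inv≡1 x x≢0 = proj₂ (inverse x x≢0)

  inv*x≡1 : ∀ x (x≢0 : x ≢ 0#) → inv x x≢0 * x ≡ 1#
  inv*x≡1 x x≢0 = ≡.trans (*-comm _ _) (x*inv≡1 x x≢0)

  x*y≡0⇒y≡0 : ∀ {x y} → x ≢ 0# → x * y ≡ 0# → y ≡ 0#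
  x*y≡0⇒y≡0 {x} {y} x≢0 xy≡0 = begin
    y                  ≡⟨ sym (*-identityˡ y) ⟩
    1# * y             ≡⟨ cong (_* y) (sym (inv*x≡1 x x≢0)) ⟩
    (inv x x≢0 * x) * y  ≡⟨ *-assoc _ x y ⟩
    inv x x≢0 * (x * y)  ≡⟨ cong (inv x x≢0 *_) xy≡0 ⟩
    inv x x≢0 * 0#       ≡⟨ zeroʳ _ ⟩
    0#                 ∎
    where open ≡-Reasoning

  x*y≡0⇒x≡0 : ∀ {x y} → y ≢ 0# → x * y ≡ 0# → x ≡ 0#
  x*y≡0⇒x≡0 {x} {y} y≢0 xy≡0 = x*y≡0⇒y≡0 y≢0 (≡.trans (*-comm y x) xy≡0)

  *-nonzero : ∀ {x y} → x ≢ 0# → y ≢ 0# → x * y ≢ 0#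
  *-nonzero x≢0 y≢0 xy≡0 = y≢0 (x*y≡0⇒y≡0 x≢0 xy≡0)

  x*y≡0⇒x≡0⊎y≡0 : ∀ {x y} → x * y ≡ 0# → x ≡ 0# ⊎ y ≡ 0#
  x*y≡0⇒x≡0⊎y≡0 {x} xy≡0 with x ≟ 0#
  ... | yes x≡0 = inj₁ x≡0
  ... | no  x≢0 = inj₂ (x*y≡0⇒y≡0 x≢0 xy≡0)

  *-cancelˡ : ∀ {x y z} → x ≢ 0# → x * y ≡ x * z → y ≡ z
  *-cancelˡ {x} {y} {z} x≢0 xy≡xz = x∙y⁻¹≈ε⇒x≈y y z (x*y≡0⇒y≡0 x≢0 (≡.trans
    (solve 3 (λ x y z → x :* (y :- z) := x :* y :- x :* z) refl x y z) (x≈y⇒x∙y⁻¹≈ε xy≡xz)))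

  linear-combination₁ : ∀ {L R A B} c → L ≡ R + c * (A + - B) → A ≡ B → L ≡ R
  linear-combination₁ {L} {R} {A} {B} c L≡ A≡B = begin
    L                   ≡⟨ L≡ ⟩
    R + c * (A + - B)   ≡⟨ cong (λ t → R + c * t) (x≈y⇒x∙y⁻¹≈ε A≡B) ⟩
    R + c * 0#          ≡⟨ cong (R +_) (zeroʳ c) ⟩
    R + 0#              ≡⟨ +-identityʳ R ⟩
    R                   ∎
    where open ≡-Reasoning

  linear-combination₂ : ∀ {L R A B C D} c d → L ≡ R + c * (A + - B) + d * (C + - D) →
                        A ≡ B → C ≡ D → L ≡ R
  linear-combination₂ c d L≡ A≡B C≡D =
    linear-combination₁ c (linear-combination₁ d L≡ C≡D) A≡B

  linear-combination₃ : ∀ {L R A B C D G H} c d e →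
                        L ≡ R + c * (A + - B) + d * (C + - D) + e * (G + - H) →
                        A ≡ B → C ≡ D → G ≡ H → L ≡ R
  linear-combination₃ c d e L≡ A≡B C≡D G≡H =
    linear-combination₂ c d (linear-combination₁ e L≡ G≡H) A≡B C≡D

  ^-distribʳ-* : ∀ x y n → (x * y) ^ n ≡ x ^ n * y ^ n
  ^-distribʳ-* x y zero    = sym (*-identityˡ 1#)
  ^-distribʳ-* x y (suc n) = ≡.trans (cong ((x * y) *_) (^-distribʳ-* x y n))
    (solve 4 (λ x y a b → (x :* y) :* (a :* b) := (x :* a) :* (y :* b)) refl x y (x ^ n) (y ^ n))

  1^n≡1 : ∀ n → 1# ^ n ≡ 1#
  1^n≡1 zero    = refl
  1^n≡1 (suc n) = ≡.trans (*-identityˡ _) (1^n≡1 n)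

  ^-nonzero : ∀ {x} n → x ≢ 0# → x ^ n ≢ 0#
  ^-nonzero zero    x≢0 = 1≢0
  ^-nonzero (suc n) x≢0 = *-nonzero x≢0 (^-nonzero n x≢0)

  |K|≡n*n⇒0^n≡0 : ∀ n → order ≡ n ℕ.* n → 0# ^ n ≡ 0#
  |K|≡n*n⇒0^n≡0 zero    |K|≡0 with () ← subst Fin |K|≡0 (Inverse.to enumeration 0#)
  |K|≡n*n⇒0^n≡0 (suc n) _     = zeroˡ _

  elements : List F
  elements = map (Inverse.from enumeration) (allFin order)

  ∈-elements : ∀ x → x ∈ elements
  ∈-elements x = subst (_∈ elements) (Inverse.strictlyInverseʳ enumeration x)
    (∈-map⁺ _ (∈-allFin (Inverse.to enumeration x)))

  elements-unique : Unique elements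
  elements-unique = Unique-map⁺ _ (λ _ _ → Injection.injective (Inverse⇒Injection (↔-sym enumeration))) (allFin⁺ order)

  length-elements : length elements ≡ order
  length-elements = ≡.trans (length-map _ (allFin order)) (length-tabulate _)

  product : List F → F
  product []       = 1#
  product (x ∷ xs) = x * product xs

  product-↭ : ∀ {xs ys} → xs ↭ ys → product xs ≡ product ys
  product-↭ Perm.refl                   = refl
  product-↭ (Perm.prep x p)             = cong (x *_) (product-↭ p)
  product-↭ (Perm.swap {ys = ys} x y p) = ≡.trans (cong (λ z → x * (y * z)) (product-↭ p))
    (solve 3 (λ x y z → x :* (y :* z) := y :* (x :* z)) refl x y (product ys))
  product-↭ (Perm.trans p p′)           = ≡.trans (product-↭ p) (product-↭ p′)

  product-map-* : ∀ a xs → product (map (a *_) xs) ≡ a ^ length xs * product xs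
  product-map-* a []       = sym (*-identityˡ 1#)
  product-map-* a (x ∷ xs) = ≡.trans (cong ((a * x) *_) (product-map-* a xs))
    (solve 4 (λ a x p r → (a :* x) :* (p :* r) := (a :* p) :* (x :* r)) refl a x (a ^ length xs) (product xs))

  product-nonzero : ∀ {xs} → All (_≢ 0#) xs → product xs ≢ 0#
  product-nonzero []         = 1≢0
  product-nonzero (x≢0 ∷ ps) = *-nonzero x≢0 (product-nonzero ps)

  -- Lagrange for the finite group S ∖ {0}: multiplication by a permutes it.
  module MultiplicativeSubgroup {S : F → Set} (S? : ∀ x → Dec (S x))
    (S-* : ∀ {x y} → S x → S y → S (x * y)) (S-inv : ∀ {x} (x≢0 : x ≢ 0#) → S x → S (inv x x≢0)) where

    units : List F
    units = filter (λ x → S? x ×-dec ¬? (x ≟ 0#)) elements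

    ∈-units : ∀ {x} → S x → x ≢ 0# → x ∈ units
    ∈-units Sx x≢0 = ∈-filter⁺ _ (∈-elements _) (Sx , x≢0)

    units-nonzero : ∀ {x} → x ∈ units → S x × x ≢ 0#
    units-nonzero x∈ = proj₂ (∈-filter⁻ _ {xs = elements} x∈)

    ^-length-units : ∀ {a} → S a → a ≢ 0# → a ^ length units ≡ 1#
    ^-length-units {a} Sa a≢0 = *-cancelˡ (product-nonzero (All.tabulate (λ x∈ → proj₂ (units-nonzero x∈))))
      (begin
        product units * a ^ length units ≡⟨ *-comm _ _ ⟩
        a ^ length units * product units ≡⟨ product-map-* a units ⟨
        product (map (a *_) units)       ≡⟨ product-↭ a*units↭units ⟩
        product units                    ≡⟨ *-identityʳ _ ⟨
        product units * 1#               ∎)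
      where
      open ≡-Reasoning
      a*units↭units : map (a *_) units ↭ units
      a*units↭units = unique-same-elements⇒↭
        (Unique-map⁺ (a *_) (λ _ _ → *-cancelˡ a≢0) (filter⁺ _ elements-unique)) (filter⁺ _ elements-unique)
        into onto
        where
        into : ∀ {x} → x ∈ map (a *_) units → x ∈ units
        into x∈ with ∈-map⁻ (a *_) x∈
        ... | y , y∈ , refl = ∈-units (S-* Sa (proj₁ (units-nonzero y∈))) (*-nonzero a≢0 (proj₂ (units-nonzero y∈)))
        onto : ∀ {x} → x ∈ units → x ∈ map (a *_) units
        onto {x} x∈ = subst (_∈ map (a *_) units) a*[a⁻¹*x]≡x (∈-map⁺ (a *_)
            (∈-units (S-* (S-inv a≢0 Sa) (proj₁ (units-nonzero x∈)))
                     (*-nonzero (λ a⁻¹≡0 → 1≢0 (≡.trans (sym (x*inv≡1 a a≢0)) (≡.trans (cong (a *_) a⁻¹≡0) (zeroʳ a))))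
                                (proj₂ (units-nonzero x∈)))))
          where
          a*[a⁻¹*x]≡x : a * (inv a a≢0 * x) ≡ x
          a*[a⁻¹*x]≡x = ≡.trans (sym (*-assoc _ _ _)) (≡.trans (cong (_* x) (x*inv≡1 a a≢0)) (*-identityˡ x))

  -- A vector of n coefficients, constant term first, is a polynomial of degree < n.
  eval : ∀ {n} → Vec F n → F → F
  eval []      z = 0#
  eval (a ∷ p) z = a + z * eval p z

  divideByRoot : ∀ {n} → F → Vec F (suc n) → Vec F n
  divideByRoot r (a ∷ [])    = []
  divideByRoot r (a ∷ b ∷ p) = eval (b ∷ p) r ∷ divideByRoot r (b ∷ p)

  eval-divideByRoot : ∀ {n} r (p : Vec F (suc n)) z →
                      eval p z ≡ (z + - r) * eval (divideByRoot r p) z + eval p r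
  eval-divideByRoot r (a ∷ [])    z =
    solve 3 (λ a z r → a :+ z :* con (ℤ.+ 0) := (z :- r) :* con (ℤ.+ 0) :+ (a :+ r :* con (ℤ.+ 0))) refl a z r
  eval-divideByRoot r (a ∷ b ∷ p) z = ≡.trans (cong (λ t → a + z * t) (eval-divideByRoot r (b ∷ p) z))
    (solve 5 (λ a z r e d → a :+ z :* ((z :- r) :* d :+ e) := (z :- r) :* (e :+ z :* d) :+ (a :+ r :* e)) refl
      a z r (eval (b ∷ p) r) (eval (divideByRoot r (b ∷ p)) z))

  eval-divideByRoot-root : ∀ {n} {r} (p : Vec F (suc n)) → eval p r ≡ 0# →
                           ∀ z → eval p z ≡ (z + - r) * eval (divideByRoot r p) z
  eval-divideByRoot-root {r = r} p pr≡0 z = ≡.trans (eval-divideByRoot r p z)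
    (≡.trans (cong ((z + - r) * eval (divideByRoot r p) z +_) pr≡0) (+-identityʳ _))

  vanishes-everywhere : ∀ {n} (p : Vec F n) {rs : List F} → Unique rs → n ≤ length rs →
                        (∀ {r} → r ∈ rs → eval p r ≡ 0#) → ∀ z → eval p z ≡ 0#
  vanishes-everywhere []               _             _         _     z = refl
  vanishes-everywhere p@(_ ∷ _) {r ∷ rs} (r∉ ∷ rs!) (s≤s n≤) roots z = begin
    eval p z                                      ≡⟨ eval-divideByRoot-root p (roots (here refl)) z ⟩
    (z + - r) * eval (divideByRoot r p) z         ≡⟨ cong ((z + - r) *_) (vanishes-everywhere (divideByRoot r p) rs! n≤ roots′ z) ⟩
    (z + - r) * 0#                                ≡⟨ zeroʳ _ ⟩
    0#                                            ∎
    where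
    open ≡-Reasoning
    roots′ : ∀ {s} → s ∈ rs → eval (divideByRoot r p) s ≡ 0#
    roots′ s∈ = x*y≡0⇒y≡0 (λ s-r≡0 → lookup r∉ s∈ (sym (x∙y⁻¹≈ε⇒x≈y _ _ s-r≡0)))
      (≡.trans (sym (eval-divideByRoot-root p (roots (here refl)) _)) (roots (there s∈)))

  addConstant : ∀ {n} → F → Vec F (suc n) → Vec F (suc n)
  addConstant k (a ∷ p) = (k + a) ∷ p

  eval-addConstant : ∀ {n} k (p : Vec F (suc n)) z → eval (addConstant k p) z ≡ k + eval p z
  eval-addConstant k (a ∷ p) z = +-assoc k a _

  mulLinearAddTop : ∀ {n} → F → F → Vec F n → Vec F (suc n)
  mulLinearAddTop c t []      = t ∷ []
  mulLinearAddTop c t (a ∷ p) = c * a ∷ addConstant a (mulLinearAddTop c t p)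

  eval-mulLinearAddTop : ∀ {n} c t (p : Vec F n) z →
                         eval (mulLinearAddTop c t p) z ≡ (c + z) * eval p z + t * z ^ n
  eval-mulLinearAddTop c t []      z =
    solve 3 (λ c t z → t :+ z :* con (ℤ.+ 0) := (c :+ z) :* con (ℤ.+ 0) :+ t :* con (ℤ.+ 1)) refl c t z
  eval-mulLinearAddTop {suc n} c t (a ∷ p) z =
    ≡.trans (cong (λ e → c * a + z * e)
              (≡.trans (eval-addConstant a (mulLinearAddTop c t p) z) (cong (a +_) (eval-mulLinearAddTop c t p z))))
      (solve 6 (λ c t z a e w → c :* a :+ z :* (a :+ ((c :+ z) :* e :+ t :* w))
                              := (c :+ z) :* (a :+ z :* e) :+ t :* (z :* w)) refl c t z a (eval p z) (z ^ n))

  binomialDifference : F → (n : ℕ) → Vec F n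
  binomialDifference c zero    = []
  binomialDifference c (suc n) = mulLinearAddTop c c (binomialDifference c n)

  eval-binomialDifference : ∀ c n z → eval (binomialDifference c n) z ≡ (c + z) ^ n + - (z ^ n)
  eval-binomialDifference c zero    z = sym (-‿inverseʳ 1#)
  eval-binomialDifference c (suc n) z = ≡.trans (eval-mulLinearAddTop c c (binomialDifference c n) z)
    (≡.trans (cong (λ e → (c + z) * e + c * z ^ n) (eval-binomialDifference c n z))
      (solve 4 (λ c z a b → (c :+ z) :* (a :- b) :+ c :* b := (c :+ z) :* a :- z :* b) refl c z ((c + z) ^ n) (z ^ n)))

  -- (c + w) ^ (n + 1) - w ^ (n + 1) - c ^ (n + 1) is a polynomial of degree ≤ n in w.
  binomial-identity-extends : ∀ n c {rs : List F} → Unique rs → suc n ≤ length rs →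
    (∀ {w} → w ∈ rs → (c + w) ^ suc n ≡ c ^ suc n + w ^ suc n) →
    ∀ w → (c + w) ^ suc n ≡ c ^ suc n + w ^ suc n
  binomial-identity-extends n c {rs} rs! n<|rs| identity w =
    x∙y⁻¹≈ε⇒x≈y _ _ (≡.trans (sym (eval-defect w))
      (vanishes-everywhere defect rs! n<|rs| (λ r∈ → defect-vanishes _ (identity r∈)) w))
    where
    defect : Vec F (suc n)
    defect = addConstant (- (c ^ suc n)) (binomialDifference c (suc n))
    eval-defect : ∀ z → eval defect z ≡ (c + z) ^ suc n + - (c ^ suc n + z ^ suc n)
    eval-defect z = ≡.trans (eval-addConstant _ (binomialDifference c (suc n)) z)
      (≡.trans (cong (- (c ^ suc n) +_) (eval-binomialDifference c (suc n) z))
      (solve 3 (λ x y z → :- z :+ (x :- y) := x :- (z :+ y)) refl ((c + z) ^ suc n) (z ^ suc n) (c ^ suc n)))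
    defect-vanishes : ∀ z → (c + z) ^ suc n ≡ c ^ suc n + z ^ suc n → eval defect z ≡ 0#
    defect-vanishes z e = ≡.trans (eval-defect z) (x≈y⇒x∙y⁻¹≈ε e)

  -- Write E for the fixed field of θ. Since θ ≠ id is an involution, F = E ⊕ E τ₀, so |E| = q;
  -- Lagrange in E* gives a ^ q ≡ a on E, so (c + w) ^ q - c ^ q - w ^ q, a polynomial of degree
  -- < q in w, vanishes on E and hence everywhere.  Then τ₀ ^ q is a root of (z - τ₀)(z - θ τ₀),
  -- whose coefficients lie in E, and τ₀ ^ q ≢ τ₀ because τ₀ ∉ E.
  module InvolutiveAutomorphism (|K|≡q*q : order ≡ q ℕ.* q)
    (θ : F → F) (θ-+ : ∀ x y → θ (x + y) ≡ θ x + θ y) (θ-* : ∀ x y → θ (x * y) ≡ θ x * θ y)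
    (θ-1 : θ 1# ≡ 1#) (θ-involutive : ∀ x → θ (θ x) ≡ x)
    (τ₀ : F) (θτ₀≢τ₀ : θ τ₀ ≢ τ₀)
    (GF[q]-fixed : ∀ x → InGFq x → θ x ≡ x) where

    Fixed : F → Set
    Fixed x = θ x ≡ x

    θ-0 : θ 0# ≡ 0#
    θ-0 = x+x≈x⇒x≈0 (θ 0#) (≡.trans (sym (θ-+ 0# 0#)) (cong θ (+-identityˡ 0#)))

    θ-neg : ∀ x → θ (- x) ≡ - θ x
    θ-neg x = +-inverseʳ-unique (θ x) (θ (- x)) (≡.trans (sym (θ-+ x (- x))) (≡.trans (cong θ (-‿inverseʳ x)) θ-0))

    fixed-+ : ∀ {a b} → Fixed a → Fixed b → Fixed (a + b)
    fixed-+ {a} {b} θa θb = ≡.trans (θ-+ a b) (cong₂ _+_ θa θb)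

    fixed-* : ∀ {a b} → Fixed a → Fixed b → Fixed (a * b)
    fixed-* {a} {b} θa θb = ≡.trans (θ-* a b) (cong₂ _*_ θa θb)

    fixed-inv : ∀ {a} (a≢0 : a ≢ 0#) → Fixed a → Fixed (inv a a≢0)
    fixed-inv {a} a≢0 θa = *-cancelˡ a≢0 (begin
      a * θ (inv a a≢0)    ≡⟨ cong (_* θ (inv a a≢0)) θa ⟨
      θ a * θ (inv a a≢0)  ≡⟨ θ-* a _ ⟨
      θ (a * inv a a≢0)    ≡⟨ cong θ (x*inv≡1 a a≢0) ⟩
      θ 1#                 ≡⟨ θ-1 ⟩
      1#                   ≡⟨ x*inv≡1 a a≢0 ⟨
      a * inv a a≢0        ∎)
      where open ≡-Reasoning

    θ-coordinates : ∀ {a b} → Fixed a → Fixed b → θ (a + b * τ₀) ≡ a + b * θ τ₀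
    θ-coordinates {a} {b} θa θb = ≡.trans (θ-+ a (b * τ₀)) (cong₂ _+_ θa (≡.trans (θ-* b τ₀) (cong (_* θ τ₀) θb)))

    δ : F
    δ = τ₀ + - θ τ₀

    δ≢0 : δ ≢ 0#
    δ≢0 δ≡0 = θτ₀≢τ₀ (sym (x∙y⁻¹≈ε⇒x≈y τ₀ (θ τ₀) δ≡0))

    θ-δ : θ δ ≡ - δ
    θ-δ = ≡.trans (θ-+ τ₀ (- θ τ₀)) (≡.trans (cong (θ τ₀ +_) (≡.trans (θ-neg (θ τ₀)) (cong -_ (θ-involutive τ₀))))
      (solve 2 (λ a b → b :- a := :- (a :- b)) refl τ₀ (θ τ₀)))

    coord₁ : F → F
    coord₁ x = (x + - θ x) * inv δ δ≢0

    coord₀ : F → F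
    coord₀ x = x + - (coord₁ x * τ₀)

    δ*coord₁ : ∀ x → δ * coord₁ x ≡ x + - θ x
    δ*coord₁ x = ≡.trans (solve 3 (λ d a i → d :* (a :* i) := a :* (d :* i)) refl δ (x + - θ x) (inv δ δ≢0))
      (≡.trans (cong ((x + - θ x) *_) (x*inv≡1 δ δ≢0)) (*-identityʳ _))

    fixed-coord₁ : ∀ x → Fixed (coord₁ x)
    fixed-coord₁ x = *-cancelˡ δ≢0 (≡.trans (linear-combination₂ (- 1#) (θ (coord₁ x))
      (solve 5 (λ d b x td tx → d :* b := (x :- tx) :+ :- con (ℤ.+ 1) :* (td :* b :- (tx :- x)) :+ b :* (td :- (:- d)))
        refl δ (θ (coord₁ x)) x (θ δ) (θ x))
      θ[δ*coord₁] θ-δ) (sym (δ*coord₁ x)))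
      where
      θ[δ*coord₁] : θ δ * θ (coord₁ x) ≡ θ x + - x
      θ[δ*coord₁] = ≡.trans (sym (θ-* δ (coord₁ x))) (≡.trans (cong θ (δ*coord₁ x))
        (≡.trans (θ-+ x (- θ x)) (cong (θ x +_) (≡.trans (θ-neg (θ x)) (cong -_ (θ-involutive x))))))

    fixed-coord₀ : ∀ x → Fixed (coord₀ x)
    fixed-coord₀ x = ≡.trans (θ-+ x (- (coord₁ x * τ₀)))
      (≡.trans (cong (θ x +_) (≡.trans (θ-neg _) (cong -_ (≡.trans (θ-* (coord₁ x) τ₀) (cong (_* θ τ₀) (fixed-coord₁ x))))))
        (linear-combination₁ 1#
          (solve 5 (λ tx b tt x t → tx :- b :* tt := x :- b :* t :+ con (ℤ.+ 1) :* ((t :- tt) :* b :- (x :- tx)))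
            refl (θ x) (coord₁ x) (θ τ₀) x τ₀)
          (δ*coord₁ x)))

    coordinates : ∀ x → x ≡ coord₀ x + coord₁ x * τ₀
    coordinates x = solve 2 (λ x b → x := (x :- b) :+ b) refl x (coord₁ x * τ₀)

    coordinates-injective : ∀ {a b c d} → Fixed a → Fixed b → Fixed c → Fixed d →
                            a + b * τ₀ ≡ c + d * τ₀ → a ≡ c × b ≡ d
    coordinates-injective {a} {b} {c} {d} θa θb θc θd e = a≡c , b≡d
      where
      conjugated : a + b * θ τ₀ ≡ c + d * θ τ₀
      conjugated = ≡.trans (sym (θ-coordinates θa θb)) (≡.trans (cong θ e) (θ-coordinates θc θd))
      b≡d : b ≡ d
      b≡d = x∙y⁻¹≈ε⇒x≈y b d (x*y≡0⇒x≡0 δ≢0 (linear-combination₂ 1# (- 1#)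
        (solve 6 (λ a b c d t tt → (b :- d) :* (t :- tt) := con (ℤ.+ 0) :+ con (ℤ.+ 1) :* ((a :+ b :* t) :- (c :+ d :* t))
           :+ :- con (ℤ.+ 1) :* ((a :+ b :* tt) :- (c :+ d :* tt))) refl a b c d τ₀ (θ τ₀))
        e conjugated))
      a≡c : a ≡ c
      a≡c = linear-combination₂ 1# τ₀
        (solve 5 (λ a c b d t → a := c :+ con (ℤ.+ 1) :* ((a :+ b :* t) :- (c :+ d :* t)) :+ t :* (d :- b)) refl a c b d τ₀)
        e (sym b≡d)

    fixedPoints : List F
    fixedPoints = filter (λ x → θ x ≟ x) elements

    fixedPoints-unique : Unique fixedPoints
    fixedPoints-unique = filter⁺ _ elements-unique

    ∈-fixedPoints : ∀ {x} → Fixed x → x ∈ fixedPoints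
    ∈-fixedPoints θx = ∈-filter⁺ _ (∈-elements _) θx

    fixedPoints-fixed : ∀ {x} → x ∈ fixedPoints → Fixed x
    fixedPoints-fixed x∈ = proj₂ (∈-filter⁻ _ {xs = elements} x∈)

    length-fixedPoints : length fixedPoints ≡ q
    length-fixedPoints = m*m≡n*n⇒m≡n (begin
      length fixedPoints ℕ.* length fixedPoints    ≡⟨ length-cartesianProductWith pair fixedPoints fixedPoints ⟨
      length (cartesianProductWith pair fixedPoints fixedPoints)
        ≡⟨ ↭-length (unique-same-elements⇒↭ pairs-unique elements-unique (λ _ → ∈-elements _) ∈-pairs) ⟩
      length elements                              ≡⟨ length-elements ⟩
      order                                        ≡⟨ |K|≡q*q ⟩
      q ℕ.* q                                      ∎)
      where
      open ≡-Reasoning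
      pair : F → F → F
      pair a b = a + b * τ₀
      pairs-unique : Unique (cartesianProductWith pair fixedPoints fixedPoints)
      pairs-unique = Unique-cartesianProductWith⁺ pair
        (λ a∈ b∈ c∈ d∈ → coordinates-injective (fixedPoints-fixed a∈) (fixedPoints-fixed b∈)
                                               (fixedPoints-fixed c∈) (fixedPoints-fixed d∈))
        fixedPoints-unique fixedPoints-unique
      ∈-pairs : ∀ {x} → x ∈ elements → x ∈ cartesianProductWith pair fixedPoints fixedPoints
      ∈-pairs {x} _ = subst (_∈ _) (sym (coordinates x))
        (∈-cartesianProductWith⁺ pair (∈-fixedPoints (fixed-coord₀ x)) (∈-fixedPoints (fixed-coord₁ x)))

    open MultiplicativeSubgroup (λ x → θ x ≟ x) fixed-* fixed-inv

    q≡1+|units| : q ≡ suc (length units)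
    q≡1+|units| = ≡.trans (sym length-fixedPoints) (↭-length (unique-same-elements⇒↭
      fixedPoints-unique (All.tabulate (λ x∈ 0≡x → proj₂ (units-nonzero x∈) (sym 0≡x)) ∷ filter⁺ _ elements-unique)
      split merge))
      where
      split : ∀ {x} → x ∈ fixedPoints → x ∈ 0# ∷ units
      split {x} x∈ with x ≟ 0#
      ... | yes x≡0 = here x≡0
      ... | no  x≢0 = there (∈-units (fixedPoints-fixed x∈) x≢0)
      merge : ∀ {x} → x ∈ 0# ∷ units → x ∈ fixedPoints
      merge (here refl) = ∈-fixedPoints θ-0
      merge (there x∈)  = ∈-fixedPoints (proj₁ (units-nonzero x∈))

    fixed⇒GF[q] : ∀ {a} → Fixed a → a ^ q ≡ a
    fixed⇒GF[q] {a} θa = subst (λ n → a ^ n ≡ a) (sym q≡1+|units|) (a^[1+|units|]≡a (a ≟ 0#))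
      where
      a^[1+|units|]≡a : Dec (a ≡ 0#) → a ^ suc (length units) ≡ a
      a^[1+|units|]≡a (yes refl) = zeroˡ _
      a^[1+|units|]≡a (no a≢0)   = ≡.trans (cong (a *_) (^-length-units θa a≢0)) (*-identityʳ a)

    frobenius-+ : ∀ x y → (x + y) ^ q ≡ x ^ q + y ^ q
    frobenius-+ x = extend x (λ {w} w∈ → ≡.trans (cong (_^ q) (+-comm x w))
      (≡.trans (extend w (λ {v} v∈ → fixed-identity (fixedPoints-fixed w∈) (fixedPoints-fixed v∈)) x) (+-comm _ _)))
      where
      extend : ∀ c → (∀ {w} → w ∈ fixedPoints → (c + w) ^ q ≡ c ^ q + w ^ q) → ∀ w → (c + w) ^ q ≡ c ^ q + w ^ q
      extend c identity = subst (λ n → ∀ w → (c + w) ^ n ≡ c ^ n + w ^ n) (sym q≡1+|units|)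
        (binomial-identity-extends (length units) c fixedPoints-unique
          (ℕ.≤-reflexive (sym (≡.trans length-fixedPoints q≡1+|units|)))
          (subst (λ n → ∀ {w} → w ∈ fixedPoints → (c + w) ^ n ≡ c ^ n + w ^ n) q≡1+|units| identity))
      fixed-identity : ∀ {c w} → Fixed c → Fixed w → (c + w) ^ q ≡ c ^ q + w ^ q
      fixed-identity θc θw = ≡.trans (fixed⇒GF[q] (fixed-+ θc θw)) (sym (cong₂ _+_ (fixed⇒GF[q] θc) (fixed⇒GF[q] θw)))

    frobenius-* : ∀ x y → (x * y) ^ q ≡ x ^ q * y ^ q
    frobenius-* x y = ^-distribʳ-* x y q

    0^q≡0 : 0# ^ q ≡ 0#
    0^q≡0 = |K|≡n*n⇒0^n≡0 q |K|≡q*q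

    frobenius-neg : ∀ x → (- x) ^ q ≡ - (x ^ q)
    frobenius-neg x = +-inverseʳ-unique (x ^ q) ((- x) ^ q)
      (≡.trans (sym (frobenius-+ x (- x))) (≡.trans (cong (_^ q) (-‿inverseʳ x)) 0^q≡0))

    τ₀^q≡θτ₀ : τ₀ ^ q ≡ θ τ₀
    τ₀^q≡θτ₀ = [ (λ τ₀^q-τ₀≡0 → ⊥-elim (θτ₀≢τ₀ (GF[q]-fixed τ₀ (x∙y⁻¹≈ε⇒x≈y _ _ τ₀^q-τ₀≡0))))
               , x∙y⁻¹≈ε⇒x≈y _ _ ]′
      (x*y≡0⇒x≡0⊎y≡0 (≡.trans (factor (τ₀ ^ q)) (≡.trans (sym frobenius-g) (≡.trans (cong (_^ q) g[τ₀]≡0) 0^q≡0))))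
      where
      s p : F
      s = τ₀ + θ τ₀
      p = τ₀ * θ τ₀
      fixed-s : Fixed s
      fixed-s = ≡.trans (θ-+ τ₀ (θ τ₀)) (≡.trans (cong (θ τ₀ +_) (θ-involutive τ₀)) (+-comm _ _))
      fixed-p : Fixed p
      fixed-p = ≡.trans (θ-* τ₀ (θ τ₀)) (≡.trans (cong (θ τ₀ *_) (θ-involutive τ₀)) (*-comm _ _))
      g : F → F
      g z = z * z + - (s * z) + p
      factor : ∀ z → (z + - τ₀) * (z + - θ τ₀) ≡ g z
      factor z = solve 3 (λ z t u → (z :- t) :* (z :- u) := z :* z :- (t :+ u) :* z :+ t :* u) refl z τ₀ (θ τ₀)
      g[τ₀]≡0 : g τ₀ ≡ 0#
      g[τ₀]≡0 = ≡.trans (sym (factor τ₀)) (≡.trans (cong (_* (τ₀ + - θ τ₀)) (-‿inverseʳ τ₀)) (zeroˡ _))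
      frobenius-g : g τ₀ ^ q ≡ g (τ₀ ^ q)
      frobenius-g = begin
        (τ₀ * τ₀ + - (s * τ₀) + p) ^ q                ≡⟨ frobenius-+ _ p ⟩
        (τ₀ * τ₀ + - (s * τ₀)) ^ q + p ^ q            ≡⟨ cong₂ _+_ (frobenius-+ _ _) (fixed⇒GF[q] fixed-p) ⟩
        (τ₀ * τ₀) ^ q + (- (s * τ₀)) ^ q + p          ≡⟨ cong (λ t → (τ₀ * τ₀) ^ q + t + p) (frobenius-neg _) ⟩
        (τ₀ * τ₀) ^ q + - ((s * τ₀) ^ q) + p          ≡⟨ cong₂ (λ t u → t + - u + p) (frobenius-* τ₀ τ₀) (frobenius-* s τ₀) ⟩
        τ₀ ^ q * τ₀ ^ q + - (s ^ q * τ₀ ^ q) + p      ≡⟨ cong (λ t → τ₀ ^ q * τ₀ ^ q + - (t * τ₀ ^ q) + p) (fixed⇒GF[q] fixed-s) ⟩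
        g (τ₀ ^ q)                                    ∎
        where open ≡-Reasoning

    θ≡frobenius : ∀ x → θ x ≡ x ^ q
    θ≡frobenius x = begin
      θ x                                  ≡⟨ cong θ (coordinates x) ⟩
      θ (a + b * τ₀)                       ≡⟨ θ-coordinates (fixed-coord₀ x) (fixed-coord₁ x) ⟩
      a + b * θ τ₀                         ≡⟨ cong₂ (λ s t → s + t * θ τ₀) (fixed⇒GF[q] (fixed-coord₀ x))
                                                                               (fixed⇒GF[q] (fixed-coord₁ x)) ⟨
      a ^ q + b ^ q * θ τ₀                 ≡⟨ cong (λ t → a ^ q + b ^ q * t) τ₀^q≡θτ₀ ⟨
      a ^ q + b ^ q * τ₀ ^ q               ≡⟨ cong (a ^ q +_) (frobenius-* b τ₀) ⟨
      a ^ q + (b * τ₀) ^ q                 ≡⟨ frobenius-+ a (b * τ₀) ⟨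
      (a + b * τ₀) ^ q                     ≡⟨ cong (_^ q) (coordinates x) ⟨
      x ^ q                                ∎
      where
      open ≡-Reasoning
      a b : F
      a = coord₀ x
      b = coord₁ x

  -- Vectors of ℓ∞

  infixl 7 _⊛_
  infixl 6 _⊞_

  _⊛_ : F → V2 → V2
  c ⊛ (x , y) = c * x , c * y

  _⊞_ : V2 → V2 → V2
  (x , y) ⊞ (x′ , y′) = x + x′ , y + y′

  0₂ : V2
  0₂ = 0# , 0#

  ⊛-assoc : ∀ k l v → k ⊛ (l ⊛ v) ≡ (k * l) ⊛ v
  ⊛-assoc k l (x , y) = ×-≡,≡→≡ (sym (*-assoc k l x) , sym (*-assoc k l y))

  ⊛-collect : ∀ c a d b v → c ⊛ (a ⊛ v) ⊞ d ⊛ (b ⊛ v) ≡ (c * a + d * b) ⊛ v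
  ⊛-collect c a d b (x , y) = ×-≡,≡→≡ (collect x , collect y)
    where
    collect : ∀ x → c * (a * x) + d * (b * x) ≡ (c * a + d * b) * x
    collect = solve 5 (λ c a d b x → c :* (a :* x) :+ d :* (b :* x) := (c :* a :+ d :* b) :* x) refl c a d b

  ⊛-collectˡ : ∀ c k d v → c ⊛ (k ⊛ v) ⊞ d ⊛ 0₂ ≡ (c * k) ⊛ v
  ⊛-collectˡ c k d (x , y) = ×-≡,≡→≡ (collect x , collect y)
    where
    collect : ∀ x → c * (k * x) + d * 0# ≡ (c * k) * x
    collect = solve 4 (λ c k d x → c :* (k :* x) :+ d :* con (ℤ.+ 0) := (c :* k) :* x) refl c k d

  ⊛-collectʳ : ∀ c d k v → c ⊛ 0₂ ⊞ d ⊛ (k ⊛ v) ≡ (d * k) ⊛ v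
  ⊛-collectʳ c d k (x , y) = ×-≡,≡→≡ (collect x , collect y)
    where
    collect : ∀ x → c * 0# + d * (k * x) ≡ (d * k) * x
    collect = solve 4 (λ c d k x → c :* con (ℤ.+ 0) :+ d :* (k :* x) := (d :* k) :* x) refl c d k

  0⊛ : ∀ v → 0# ⊛ v ≡ 0₂
  0⊛ (x , y) = ×-≡,≡→≡ (zeroˡ x , zeroˡ y)

  ⊛-zeroˡ-nonzero : ∀ {s v} → NonZero2 v → s ⊛ v ≡ 0₂ → s ≡ 0#
  ⊛-zeroˡ-nonzero {s} {a , a′} v≢0 sv≡0 with a ≟ 0# | a′ ≟ 0#
  ... | no a≢0  | _         = x*y≡0⇒x≡0 a≢0 (cong proj₁ sv≡0)
  ... | yes _   | no a′≢0   = x*y≡0⇒x≡0 a′≢0 (cong proj₂ sv≡0)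
  ... | yes a≡0 | yes a′≡0  = ⊥-elim (v≢0 (a≡0 , a′≡0))

  Same2⇒≡⊛ : ∀ {v v′} → Same2 v v′ → Σ[ l ∈ F ] l ≢ 0# × v ≡ l ⊛ v′
  Same2⇒≡⊛ (l , l≢0 , e₁ , e₂) = l , l≢0 , ×-≡,≡→≡ (e₁ , e₂)

  ≡⊛⇒Same2 : ∀ {v v′ l} → l ≢ 0# → v ≡ l ⊛ v′ → Same2 v v′
  ≡⊛⇒Same2 {l = l} l≢0 refl = l , l≢0 , refl , refl

  1⊛ : ∀ v → 1# ⊛ v ≡ v
  1⊛ (x , y) = ×-≡,≡→≡ (*-identityˡ x , *-identityˡ y)

  Same2-sym : ∀ {v v′} → Same2 v v′ → Same2 v′ v
  Same2-sym {v} {v′} v~v′ with Same2⇒≡⊛ v~v′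
  ... | l , l≢0 , refl = ≡⊛⇒Same2 l⁻¹≢0 (begin
    v′                        ≡⟨ 1⊛ v′ ⟨
    1# ⊛ v′                   ≡⟨ cong (_⊛ v′) (inv*x≡1 l l≢0) ⟨
    (inv l l≢0 * l) ⊛ v′      ≡⟨ ⊛-assoc _ l v′ ⟨
    inv l l≢0 ⊛ (l ⊛ v′)      ∎)
    where
    open ≡-Reasoning
    l⁻¹≢0 : inv l l≢0 ≢ 0#
    l⁻¹≢0 l⁻¹≡0 = 1≢0 (≡.trans (sym (x*inv≡1 l l≢0)) (≡.trans (cong (l *_) l⁻¹≡0) (zeroʳ l)))

  Same2-trans : ∀ {v v′ v″} → Same2 v v′ → Same2 v′ v″ → Same2 v v″
  Same2-trans {v″ = v″} v~v′ v′~v″ with Same2⇒≡⊛ v~v′ | Same2⇒≡⊛ v′~v″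
  ... | l , l≢0 , refl | m , m≢0 , refl = ≡⊛⇒Same2 (*-nonzero l≢0 m≢0) (⊛-assoc l m v″)

  module Basis (u w : V2) (det≢0 : proj₁ u * proj₂ w + - (proj₂ u * proj₁ w) ≢ 0#) where

    lc : F → F → V2
    lc α β = α ⊛ u ⊞ β ⊛ w

    u₀ u₁ w₀ w₁ det : F
    u₀ = proj₁ u
    u₁ = proj₂ u
    w₀ = proj₁ w
    w₁ = proj₂ w
    det = u₀ * w₁ + - (u₁ * w₀)

    lc-injective : ∀ {α β γ δ} → lc α β ≡ lc γ δ → α ≡ γ × β ≡ δ
    lc-injective {α} {β} {γ} {δ} e = *-cancelˡ det≢0 (linear-combination₂ w₁ (- w₀)
        (solve 8 (λ α β γ δ u₀ u₁ w₀ w₁ → (u₀ :* w₁ :- u₁ :* w₀) :* α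
                   := (u₀ :* w₁ :- u₁ :* w₀) :* γ :+ w₁ :* (α :* u₀ :+ β :* w₀ :- (γ :* u₀ :+ δ :* w₀))
                      :+ :- w₀ :* (α :* u₁ :+ β :* w₁ :- (γ :* u₁ :+ δ :* w₁))) refl α β γ δ u₀ u₁ w₀ w₁)
        (cong proj₁ e) (cong proj₂ e))
      , *-cancelˡ det≢0 (linear-combination₂ (- u₁) u₀
        (solve 8 (λ α β γ δ u₀ u₁ w₀ w₁ → (u₀ :* w₁ :- u₁ :* w₀) :* β
                   := (u₀ :* w₁ :- u₁ :* w₀) :* δ :+ :- u₁ :* (α :* u₀ :+ β :* w₀ :- (γ :* u₀ :+ δ :* w₀))
                      :+ u₀ :* (α :* u₁ :+ β :* w₁ :- (γ :* u₁ :+ δ :* w₁))) refl α β γ δ u₀ u₁ w₀ w₁)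
        (cong proj₁ e) (cong proj₂ e))

    -- Cramer's rule.
    lc-surjective : ∀ v → Σ[ α ∈ F ] Σ[ β ∈ F ] v ≡ lc α β
    lc-surjective (v₀ , v₁) = α , β , ×-≡,≡→≡ (component₀ , component₁)
      where
      d⁻¹ α β : F
      d⁻¹ = inv det det≢0
      α = (v₀ * w₁ + - (v₁ * w₀)) * d⁻¹
      β = (u₀ * v₁ + - (u₁ * v₀)) * d⁻¹
      component₀ : v₀ ≡ α * u₀ + β * w₀
      component₀ = linear-combination₁ (- v₀)
        (solve 7 (λ v₀ v₁ u₀ u₁ w₀ w₁ i → v₀ := ((v₀ :* w₁ :- v₁ :* w₀) :* i) :* u₀ :+ ((u₀ :* v₁ :- u₁ :* v₀) :* i) :* w₀
                    :+ :- v₀ :* ((u₀ :* w₁ :- u₁ :* w₀) :* i :- con (ℤ.+ 1))) refl v₀ v₁ u₀ u₁ w₀ w₁ d⁻¹)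
        (x*inv≡1 det det≢0)
      component₁ : v₁ ≡ α * u₁ + β * w₁
      component₁ = linear-combination₁ (- v₁)
        (solve 7 (λ v₀ v₁ u₀ u₁ w₀ w₁ i → v₁ := ((v₀ :* w₁ :- v₁ :* w₀) :* i) :* u₁ :+ ((u₀ :* v₁ :- u₁ :* v₀) :* i) :* w₁
                    :+ :- v₁ :* ((u₀ :* w₁ :- u₁ :* w₀) :* i :- con (ℤ.+ 1))) refl v₀ v₁ u₀ u₁ w₀ w₁ d⁻¹)
        (x*inv≡1 det det≢0)

    ⊛-lc : ∀ k α β → k ⊛ lc α β ≡ lc (k * α) (k * β)
    ⊛-lc k α β = ×-≡,≡→≡ (distributes u₀ w₀ , distributes u₁ w₁)
      where
      distributes : ∀ x y → k * (α * x + β * y) ≡ k * α * x + k * β * y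
      distributes = solve 5 (λ k α β x y → k :* (α :* x :+ β :* y) := k :* α :* x :+ k :* β :* y) refl k α β

    lc-linear : ∀ α β a b c d → α ⊛ lc a b ⊞ β ⊛ lc c d ≡ lc (α * a + β * c) (α * b + β * d)
    lc-linear α β a b c d = ×-≡,≡→≡ (expand u₀ w₀ , expand u₁ w₁)
      where
      expand : ∀ x y → α * (a * x + b * y) + β * (c * x + d * y) ≡ (α * a + β * c) * x + (α * b + β * d) * y
      expand = solve 8 (λ α β a b c d x y → α :* (a :* x :+ b :* y) :+ β :* (c :* x :+ d :* y)
                                          := (α :* a :+ β :* c) :* x :+ (α :* b :+ β :* d) :* y) refl α β a b c d

    lc-axes : ∀ x p y r → x ⊛ (p ⊛ lc 1# 0#) ⊞ y ⊛ (r ⊛ lc 0# 1#) ≡ lc (x * p) (y * r)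
    lc-axes x p y r = ×-≡,≡→≡ (expand u₀ w₀ , expand u₁ w₁)
      where
      expand : ∀ a b → x * (p * (1# * a + 0# * b)) + y * (r * (0# * a + 1# * b)) ≡ x * p * a + y * r * b
      expand = solve 6 (λ x p y r a b → x :* (p :* (con (ℤ.+ 1) :* a :+ con (ℤ.+ 0) :* b))
                                       :+ y :* (r :* (con (ℤ.+ 0) :* a :+ con (ℤ.+ 1) :* b))
                                    := x :* p :* a :+ y :* r :* b) refl x p y r

    lc-0-0 : lc 0# 0# ≡ 0₂
    lc-0-0 = ×-≡,≡→≡ (vanish u₀ w₀ , vanish u₁ w₁)
      where
      vanish : ∀ x y → 0# * x + 0# * y ≡ 0#
      vanish = solve 2 (λ x y → con (ℤ.+ 0) :* x :+ con (ℤ.+ 0) :* y := con (ℤ.+ 0)) refl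

    lc-nonzero : ∀ {α β} → ¬ (α ≡ 0# × β ≡ 0#) → NonZero2 (lc α β)
    lc-nonzero {α} {β} αβ≢0 (e₀ , e₁) = αβ≢0 (lc-injective (≡.trans (×-≡,≡→≡ (e₀ , e₁)) (sym lc-0-0)))

    nonzero-lc : ∀ {α β} → NonZero2 (lc α β) → ¬ (α ≡ 0# × β ≡ 0#)
    nonzero-lc lc≢0 (refl , refl) = lc≢0 (cong proj₁ lc-0-0 , cong proj₂ lc-0-0)

  module BaerInvolution (|K|≡q*q : order ≡ q ℕ.* q) (b : BaerSubline) (c : Collineation)
                        (baer-involution : IsBaerInvolution b c) where
    open BaerSubline b
    open Basis u w det≢0
    open Collineation c

    σ-lc-basis : ∀ α β → σ (lc α β) ≡ θ α ⊛ σ (lc 1# 0#) ⊞ θ β ⊛ σ (lc 0# 1#)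
    σ-lc-basis α β = begin
      σ (lc α β)                                         ≡⟨ cong σ (≡.trans (cong₂ lc (unit₁ α β) (unit₂ α β))
                                                                            (sym (lc-linear α β 1# 0# 0# 1#))) ⟩
      σ (α ⊛ lc 1# 0# ⊞ β ⊛ lc 0# 1#)                    ≡⟨ σ-+ _ _ _ _ ⟩
      σ (α ⊛ lc 1# 0#) ⊞ σ (β ⊛ lc 0# 1#)               ≡⟨ cong₂ _⊞_ (σ-semi α _ _) (σ-semi β _ _) ⟩
      θ α ⊛ σ (lc 1# 0#) ⊞ θ β ⊛ σ (lc 0# 1#)            ∎
      where
      open ≡-Reasoning
      unit₁ : ∀ α β → α ≡ α * 1# + β * 0#
      unit₁ = solve 2 (λ α β → α := α :* con (ℤ.+ 1) :+ β :* con (ℤ.+ 0)) refl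
      unit₂ : ∀ α β → β ≡ α * 0# + β * 1#
      unit₂ = solve 2 (λ α β → β := α :* con (ℤ.+ 0) :+ β :* con (ℤ.+ 1)) refl

    GF[q]-0 : InGFq 0#
    GF[q]-0 = |K|≡n*n⇒0^n≡0 q |K|≡q*q

    GF[q]-1 : InGFq 1#
    GF[q]-1 = 1^n≡1 q

    baer-point-fixed : ∀ {α β} → InGFq α → InGFq β → ¬ (α ≡ 0# × β ≡ 0#) →
                       Σ[ l ∈ F ] l ≢ 0# × σ (lc α β) ≡ lc (l * α) (l * β)
    baer-point-fixed {α} {β} qα qβ αβ≢0 = scaled (Same2⇒≡⊛ (proj₂ (proj₂ baer-involution) (lc α β) (lc-nonzero αβ≢0)
      (α , β , qα , qβ , αβ≢0 , 1# , 1≢0 , sym (*-identityˡ _) , sym (*-identityˡ _))))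
      where
      scaled : Σ[ l ∈ F ] l ≢ 0# × σ (lc α β) ≡ l ⊛ lc α β → Σ[ l ∈ F ] l ≢ 0# × σ (lc α β) ≡ lc (l * α) (l * β)
      scaled (l , l≢0 , e) = l , l≢0 , ≡.trans e (⊛-lc l α β)

    *θ1 : ∀ l → l * θ 1# ≡ l
    *θ1 l = ≡.trans (cong (l *_) θ-1) (*-identityʳ l)

    private
      u-fixed = baer-point-fixed GF[q]-1 GF[q]-0 (λ (1≡0 , _) → 1≢0 1≡0)
      w-fixed = baer-point-fixed GF[q]-0 GF[q]-1 (λ (_ , 1≡0) → 1≢0 1≡0)
      u+w-fixed = baer-point-fixed GF[q]-1 GF[q]-1 (λ (1≡0 , _) → 1≢0 1≡0)

    ϱ : F
    ϱ = proj₁ u-fixed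

    ϱ≢0 : ϱ ≢ 0#
    ϱ≢0 = proj₁ (proj₂ u-fixed)

    private
      λʷ : F
      λʷ = proj₁ w-fixed

      σ-lc′ : ∀ α β → σ (lc α β) ≡ lc (ϱ * θ α) (λʷ * θ β)
      σ-lc′ α β = begin
        σ (lc α β)                                                        ≡⟨ σ-lc-basis α β ⟩
        θ α ⊛ σ (lc 1# 0#) ⊞ θ β ⊛ σ (lc 0# 1#)                           ≡⟨ cong₂ (λ s t → θ α ⊛ s ⊞ θ β ⊛ t)
                                                                               (proj₂ (proj₂ u-fixed))
                                                                               (proj₂ (proj₂ w-fixed)) ⟩
        θ α ⊛ lc (ϱ * 1#) (ϱ * 0#) ⊞ θ β ⊛ lc (λʷ * 0#) (λʷ * 1#)         ≡⟨ lc-linear (θ α) (θ β) _ _ _ _ ⟩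
        lc (θ α * (ϱ * 1#) + θ β * (λʷ * 0#)) (θ α * (ϱ * 0#) + θ β * (λʷ * 1#))
          ≡⟨ cong₂ lc (simplify₁ (θ α) (θ β) ϱ λʷ) (simplify₂ (θ α) (θ β) ϱ λʷ) ⟩
        lc (ϱ * θ α) (λʷ * θ β)                                           ∎
        where
        open ≡-Reasoning
        simplify₁ : ∀ a b l m → a * (l * 1#) + b * (m * 0#) ≡ l * a
        simplify₁ = solve 4 (λ a b l m → a :* (l :* con (ℤ.+ 1)) :+ b :* (m :* con (ℤ.+ 0)) := l :* a) refl
        simplify₂ : ∀ a b l m → a * (l * 0#) + b * (m * 1#) ≡ m * b
        simplify₂ = solve 4 (λ a b l m → a :* (l :* con (ℤ.+ 0)) :+ b :* (m :* con (ℤ.+ 1)) := m :* b) refl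

      λʷ≡ϱ : λʷ ≡ ϱ
      λʷ≡ϱ = ≡.trans (sym (*θ1 λʷ)) (≡.trans (proj₂ same) (≡.trans (sym (proj₁ same)) (*θ1 ϱ)))
        where
        same = lc-injective (≡.trans (sym (σ-lc′ 1# 1#)) (proj₂ (proj₂ u+w-fixed)))

    σ-lc : ∀ α β → σ (lc α β) ≡ lc (ϱ * θ α) (ϱ * θ β)
    σ-lc α β = ≡.trans (σ-lc′ α β) (cong (λ l → lc (ϱ * θ α) (l * θ β)) λʷ≡ϱ)

    GF[q]-fixed : ∀ α → InGFq α → θ α ≡ α
    GF[q]-fixed α qα = *-cancelˡ ϱ≢0 (≡.trans (proj₁ same) (cong (_* α) (sym ϱ≡l)))
      where
      α1-fixed = baer-point-fixed qα GF[q]-1 (λ (_ , 1≡0) → 1≢0 1≡0)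
      same = lc-injective (≡.trans (sym (σ-lc α 1#)) (proj₂ (proj₂ α1-fixed)))
      ϱ≡l : ϱ ≡ proj₁ α1-fixed
      ϱ≡l = ≡.trans (sym (*θ1 ϱ)) (≡.trans (proj₂ same) (*-identityʳ _))

    θ-nonzero : ∀ {x} → x ≢ 0# → θ x ≢ 0#
    θ-nonzero {x} x≢0 θx≡0 = 1≢0 (begin
      1#                      ≡⟨ sym θ-1 ⟩
      θ 1#                    ≡⟨ cong θ (x*inv≡1 x x≢0) ⟨
      θ (x * inv x x≢0)       ≡⟨ θ-* x _ ⟩
      θ x * θ (inv x x≢0)     ≡⟨ cong (_* θ (inv x x≢0)) θx≡0 ⟩
      0# * θ (inv x x≢0)      ≡⟨ zeroˡ _ ⟩
      0#                      ∎)
      where open ≡-Reasoning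

    θ-involutive : ∀ β → θ (θ β) ≡ β
    θ-involutive β = *-cancelˡ (*-nonzero ϱ≢0 (θ-nonzero ϱ≢0)) (begin
      ϱ * θ ϱ * θ (θ β)      ≡⟨ *-assoc ϱ _ _ ⟩
      ϱ * (θ ϱ * θ (θ β))    ≡⟨ cong (ϱ *_) (θ-* ϱ (θ β)) ⟨
      ϱ * θ (ϱ * θ β)        ≡⟨ proj₂ same ⟩
      l * β                  ≡⟨ cong (_* β) l≡ϱθϱ ⟩
      ϱ * θ ϱ * β            ∎)
      where
      open ≡-Reasoning
      σσ-fixed = Same2⇒≡⊛ (proj₁ baer-involution (lc 1# β) (lc-nonzero (λ (1≡0 , _) → 1≢0 1≡0)))
      l : F
      l = proj₁ σσ-fixed
      σσ : σ (σ (lc 1# β)) ≡ lc (ϱ * θ (ϱ * θ 1#)) (ϱ * θ (ϱ * θ β))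
      σσ = ≡.trans (cong σ (σ-lc 1# β)) (σ-lc _ _)
      same = lc-injective (≡.trans (sym σσ) (≡.trans (proj₂ (proj₂ σσ-fixed)) (⊛-lc l 1# β)))
      l≡ϱθϱ : l ≡ ϱ * θ ϱ
      l≡ϱθϱ = ≡.trans (sym (*-identityʳ l)) (≡.trans (sym (proj₁ same)) (cong (λ t → ϱ * θ t) (*θ1 ϱ)))

    non-identity : Σ[ τ₀ ∈ F ] θ τ₀ ≢ τ₀
    non-identity = pick (θ α ≟ α) (θ β ≟ β)
      where
      non-fixed = proj₁ (proj₂ baer-involution)
      v : V2
      v = proj₁ non-fixed
      α β : F
      α = proj₁ (lc-surjective v)
      β = proj₁ (proj₂ (lc-surjective v))
      v≡lc : v ≡ lc α β
      v≡lc = proj₂ (proj₂ (lc-surjective v))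
      pick : Dec (θ α ≡ α) → Dec (θ β ≡ β) → Σ[ τ₀ ∈ F ] θ τ₀ ≢ τ₀
      pick (no θα≢α)  _           = α , θα≢α
      pick (yes _)    (no θβ≢β)   = β , θβ≢β
      pick (yes θα≡α) (yes θβ≡β)  = ⊥-elim (proj₂ (proj₂ non-fixed) (≡⊛⇒Same2 ϱ≢0 (begin
        σ v                         ≡⟨ cong σ v≡lc ⟩
        σ (lc α β)                  ≡⟨ σ-lc α β ⟩
        lc (ϱ * θ α) (ϱ * θ β)      ≡⟨ cong₂ (λ s t → lc (ϱ * s) (ϱ * t)) θα≡α θβ≡β ⟩
        lc (ϱ * α) (ϱ * β)          ≡⟨ ⊛-lc ϱ α β ⟨
        ϱ ⊛ lc α β                  ≡⟨ cong (ϱ ⊛_) v≡lc ⟨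
        ϱ ⊛ v                       ∎)))
        where open ≡-Reasoning

    open InvolutiveAutomorphism |K|≡q*q θ θ-+ θ-* θ-1 θ-involutive (proj₁ non-identity) (proj₂ non-identity) GF[q]-fixed
      public using (θ≡frobenius; frobenius-+)

    frobenius-involutive : ∀ x → frob (frob x) ≡ x
    frobenius-involutive x = ≡.trans (sym (θ≡frobenius (frob x))) (≡.trans (cong θ (sym (θ≡frobenius x))) (θ-involutive x))

    σ-lc-frobenius : ∀ α β → σ (lc α β) ≡ ϱ ⊛ lc (frob α) (frob β)
    σ-lc-frobenius α β = ≡.trans (σ-lc α β) (≡.trans (cong₂ (λ s t → lc (ϱ * s) (ϱ * t)) (θ≡frobenius α) (θ≡frobenius β))
      (sym (⊛-lc ϱ (frob α) (frob β))))


  -- Vectors of PG(4,q²)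

  comb : F → V5 → F → V5 → V5
  comb c A d B i = c * A i + d * B i

  NonZero5⇒¬zero : ∀ {X} → NonZero5 X → ¬ (∀ i → X i ≡ 0#)
  NonZero5⇒¬zero (i , Xi≢0) X≡0 = Xi≢0 (X≡0 i)

  ¬zero⇒NonZero5 : ∀ {X} → ¬ (∀ i → X i ≡ 0#) → NonZero5 X
  ¬zero⇒NonZero5 {X} = Fin.¬∀⟶∃¬ 5 (λ i → X i ≡ 0#) (λ i → X i ≟ 0#)

  comb-0-0 : ∀ (P Q : V5) i → 0# * P i + 0# * Q i ≡ 0#
  comb-0-0 P Q i = solve 2 (λ p r → con (ℤ.+ 0) :* p :+ con (ℤ.+ 0) :* r := con (ℤ.+ 0)) refl (P i) (Q i)

  comb-c4 : ∀ c P d Q → P c4 ≡ 0# → Q c4 ≡ 0# → comb c P d Q c4 ≡ 0#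
  comb-c4 c P d Q P₄≡0 Q₄≡0 = ≡.trans (cong₂ (λ s t → c * s + d * t) P₄≡0 Q₄≡0)
    (solve 2 (λ c d → c :* con (ℤ.+ 0) :+ d :* con (ℤ.+ 0) := con (ℤ.+ 0)) refl c d)

  comb-span : ∀ {G₁ G₂ A B} x y → InSpan A G₁ G₂ → InSpan B G₁ G₂ → InSpan (comb x A y B) G₁ G₂
  comb-span {G₁} {G₂} {A} {B} x y (a₁ , a₂ , A≗) (b₁ , b₂ , B≗) = x * a₁ + y * b₁ , x * a₂ + y * b₂ , λ i →
    ≡.trans (cong₂ (λ s t → x * s + y * t) (A≗ i) (B≗ i))
      (solve 8 (λ x y a₁ a₂ b₁ b₂ g₁ g₂ → x :* (a₁ :* g₁ :+ a₂ :* g₂) :+ y :* (b₁ :* g₁ :+ b₂ :* g₂)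
                                       := (x :* a₁ :+ y :* b₁) :* g₁ :+ (x :* a₂ :+ y :* b₂) :* g₂) refl x y a₁ a₂ b₁ b₂ (G₁ i) (G₂ i))

  span-independent : ∀ {G₁ G₂ A B X} → Independent A B → InSpan A G₁ G₂ → InSpan B G₁ G₂ →
                     InSpan X G₁ G₂ → InSpan X A B
  span-independent {G₁} {G₂} {A} {B} {X} A⊥B (a₁ , a₂ , A≗) (b₁ , b₂ , B≗) (x₁ , x₂ , X≗) =
    c , d , λ i → ≡.trans (X≗ i) (≡.trans (linear-combination₁ (- (x₁ * G₁ i + x₂ * G₂ i))
      (solve 9 (λ x₁ x₂ a₁ a₂ b₁ b₂ e g₁ g₂ →
         x₁ :* g₁ :+ x₂ :* g₂ := ((x₁ :* b₂ :- x₂ :* b₁) :* e) :* (a₁ :* g₁ :+ a₂ :* g₂)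
                                :+ ((a₁ :* x₂ :- a₂ :* x₁) :* e) :* (b₁ :* g₁ :+ b₂ :* g₂)
                                :+ :- (x₁ :* g₁ :+ x₂ :* g₂) :* ((a₁ :* b₂ :- a₂ :* b₁) :* e :- con (ℤ.+ 1)))
        refl x₁ x₂ a₁ a₂ b₁ b₂ (inv D D≢0) (G₁ i) (G₂ i))
      (x*inv≡1 D D≢0)) (sym (cong₂ (λ s t → c * s + d * t) (A≗ i) (B≗ i))))
    where
    D : F
    D = a₁ * b₂ + - (a₂ * b₁)
    vanishing : ∀ s t → s * a₁ + t * b₁ ≡ 0# → s * a₂ + t * b₂ ≡ 0# → s ≡ 0# × t ≡ 0#
    vanishing s t e₁ e₂ = A⊥B s t λ i → begin
      s * A i + t * B i                                              ≡⟨ cong₂ (λ a b → s * a + t * b) (A≗ i) (B≗ i) ⟩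
      s * (a₁ * G₁ i + a₂ * G₂ i) + t * (b₁ * G₁ i + b₂ * G₂ i)      ≡⟨ solve 8 (λ s t a₁ a₂ b₁ b₂ g₁ g₂ →
           s :* (a₁ :* g₁ :+ a₂ :* g₂) :+ t :* (b₁ :* g₁ :+ b₂ :* g₂) := (s :* a₁ :+ t :* b₁) :* g₁ :+ (s :* a₂ :+ t :* b₂) :* g₂)
           refl s t a₁ a₂ b₁ b₂ (G₁ i) (G₂ i) ⟩
      (s * a₁ + t * b₁) * G₁ i + (s * a₂ + t * b₂) * G₂ i          ≡⟨ cong₂ (λ a b → a * G₁ i + b * G₂ i) e₁ e₂ ⟩
      0# * G₁ i + 0# * G₂ i                                          ≡⟨ comb-0-0 G₁ G₂ i ⟩
      0#                                                             ∎
      where open ≡-Reasoning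
    -x≡0⇒x≡0 : ∀ {x} → - x ≡ 0# → x ≡ 0#
    -x≡0⇒x≡0 {x} -x≡0 = ≡.trans (sym (-‿involutive x)) (≡.trans (cong -_ -x≡0) -0#≈0#)
    -- If D ≡ 0 then b₂ A - a₂ B and b₁ A - a₁ B vanish, forcing a₁ ≡ a₂ ≡ 0.
    D≢0 : D ≢ 0#
    D≢0 D≡0 = 1≢0 (proj₁ (vanishing 1# 0# (unit-combination a₁≡0) (unit-combination a₂≡0)))
      where
      a₂≡0 : a₂ ≡ 0#
      a₂≡0 = -x≡0⇒x≡0 (proj₂ (vanishing b₂ (- a₂)
        (≡.trans (solve 4 (λ a₁ a₂ b₁ b₂ → b₂ :* a₁ :+ :- a₂ :* b₁ := a₁ :* b₂ :- a₂ :* b₁) refl a₁ a₂ b₁ b₂) D≡0)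
        (solve 2 (λ a₂ b₂ → b₂ :* a₂ :+ :- a₂ :* b₂ := con (ℤ.+ 0)) refl a₂ b₂)))
      a₁≡0 : a₁ ≡ 0#
      a₁≡0 = -x≡0⇒x≡0 (proj₂ (vanishing b₁ (- a₁)
        (solve 2 (λ a₁ b₁ → b₁ :* a₁ :+ :- a₁ :* b₁ := con (ℤ.+ 0)) refl a₁ b₁)
        (≡.trans (solve 4 (λ a₁ a₂ b₁ b₂ → b₁ :* a₂ :+ :- a₁ :* b₂ := :- (a₁ :* b₂ :- a₂ :* b₁)) refl a₁ a₂ b₁ b₂)
          (≡.trans (cong -_ D≡0) -0#≈0#))))
      unit-combination : ∀ {a b} → a ≡ 0# → 1# * a + 0# * b ≡ 0#
      unit-combination {b = b} refl = solve 1 (λ b → con (ℤ.+ 1) :* con (ℤ.+ 0) :+ con (ℤ.+ 0) :* b := con (ℤ.+ 0)) refl b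
    c d : F
    c = (x₁ * b₂ + - (x₂ * b₁)) * inv D D≢0
    d = (a₁ * x₂ + - (a₂ * x₁)) * inv D D≢0

  InExtRegulus-sym : ∀ {t b A B} → InExtRegulus t b A B → InExtRegulus t b B A
  InExtRegulus-sym (A⊥B , meets) =
    (λ s t tB+sA≡0 → swap (A⊥B t s (λ i → ≡.trans (+-comm _ _) (tB+sA≡0 i)))) ,
    λ m m-opp → let (X , (X≢0 , c , d , X≗) , X∈m) = meets m m-opp in
      X , (X≢0 , d , c , λ i → ≡.trans (X≗ i) (+-comm _ _)) , X∈m

  module BruckBose (τ : F) (τ∉GF[q] : ¬ InGFq τ)
    (frob-+ : ∀ x y → frob (x + y) ≡ frob x + frob y) (frob-involutive : ∀ x → frob (frob x) ≡ x) where

    τ′ : F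
    τ′ = frob τ

    frob-* : ∀ x y → frob (x * y) ≡ frob x * frob y
    frob-* x y = ^-distribʳ-* x y q

    frob-0 : frob 0# ≡ 0#
    frob-0 = x+x≈x⇒x≈0 _ (≡.trans (sym (frob-+ 0# 0#)) (cong frob (+-identityˡ 0#)))

    frob-neg : ∀ x → frob (- x) ≡ - frob x
    frob-neg x = +-inverseʳ-unique (frob x) (frob (- x))
      (≡.trans (sym (frob-+ x (- x))) (≡.trans (cong frob (-‿inverseʳ x)) frob-0))

    frobV : V2 → V2
    frobV (x , y) = frob x , frob y

    frobV-⊛ : ∀ k v → frobV (k ⊛ v) ≡ frob k ⊛ frobV v
    frobV-⊛ k (x , y) = ×-≡,≡→≡ (frob-* k x , frob-* k y)

    frobV-involutive : ∀ v → frobV (frobV v) ≡ v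
    frobV-involutive (x , y) = ×-≡,≡→≡ (frob-involutive x , frob-involutive y)

    frobV-0 : frobV 0₂ ≡ 0₂
    frobV-0 = ×-≡,≡→≡ (frob-0 , frob-0)

    φ : F → V5 → V2
    φ t X = X c0 + X c1 * t , X c2 + X c3 * t

    φ-comb : ∀ t c A d B → φ t (comb c A d B) ≡ c ⊛ φ t A ⊞ d ⊛ φ t B
    φ-comb t c A d B = ×-≡,≡→≡ (regroup c0 c1 , regroup c2 c3)
      where
      regroup : ∀ i j → (c * A i + d * B i) + (c * A j + d * B j) * t ≡ c * (A i + A j * t) + d * (B i + B j * t)
      regroup i j = solve 7 (λ c d ai bi aj bj t → (c :* ai :+ d :* bi) :+ (c :* aj :+ d :* bj) :* t
                                                := c :* (ai :+ aj :* t) :+ d :* (bi :+ bj :* t)) refl c d (A i) (B i) (A j) (B j) t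

    φ-cong : ∀ t {X Y} → (∀ i → X i ≡ Y i) → φ t X ≡ φ t Y
    φ-cong t X≗Y = ×-≡,≡→≡ (cong₂ (λ a b → a + b * t) (X≗Y c0) (X≗Y c1) , cong₂ (λ a b → a + b * t) (X≗Y c2) (X≗Y c3))

    φ-conj : ∀ t X → φ (frob t) (conj X) ≡ frobV (φ t X)
    φ-conj t X = ×-≡,≡→≡ (frob-linear c0 c1 , frob-linear c2 c3)
      where
      frob-linear : ∀ i j → frob (X i) + frob (X j) * frob t ≡ frob (X i + X j * t)
      frob-linear i j = sym (≡.trans (frob-+ (X i) (X j * t)) (cong (frob (X i) +_) (frob-* (X j) t)))

    τ-independent : ∀ {a b} → a + b * τ ≡ 0# → a + b * τ′ ≡ 0# → a ≡ 0# × b ≡ 0#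
    τ-independent {a} {b} e e′ = a≡0 , b≡0
      where
      b≡0 : b ≡ 0#
      b≡0 = x*y≡0⇒x≡0 (λ τ-τ′≡0 → τ∉GF[q] (sym (x∙y⁻¹≈ε⇒x≈y τ τ′ τ-τ′≡0))) (linear-combination₂ 1# (- 1#)
        (solve 4 (λ a b t u → b :* (t :- u) := con (ℤ.+ 0) :+ con (ℤ.+ 1) :* ((a :+ b :* t) :- con (ℤ.+ 0))
                                               :+ :- con (ℤ.+ 1) :* ((a :+ b :* u) :- con (ℤ.+ 0))) refl a b τ τ′) e e′)
      a≡0 : a ≡ 0#
      a≡0 = linear-combination₂ 1# (- τ)
        (solve 3 (λ a b t → a := con (ℤ.+ 0) :+ con (ℤ.+ 1) :* ((a :+ b :* t) :- con (ℤ.+ 0)) :+ :- t :* (b :- con (ℤ.+ 0)))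
          refl a b τ) e b≡0

    φ-kernel : ∀ {X} → X c4 ≡ 0# → φ τ X ≡ 0₂ → φ τ′ X ≡ 0₂ → ∀ i → X i ≡ 0#
    φ-kernel {X} X₄≡0 φX≡0 φ′X≡0 = vanish
      where
      first  = τ-independent (cong proj₁ φX≡0) (cong proj₁ φ′X≡0)
      second = τ-independent (cong proj₂ φX≡0) (cong proj₂ φ′X≡0)
      vanish : ∀ i → X i ≡ 0#
      vanish f0                     = proj₁ first
      vanish (fs f0)                = proj₂ first
      vanish (fs (fs f0))           = proj₁ second
      vanish (fs (fs (fs f0)))      = proj₂ second
      vanish (fs (fs (fs (fs f0)))) = X₄≡0

    φ-injective : ∀ {X Y} → X c4 ≡ Y c4 → φ τ X ≡ φ τ Y → φ τ′ X ≡ φ τ′ Y → ∀ i → X i ≡ Y i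
    φ-injective {X} {Y} X₄≡Y₄ φX≡φY φ′X≡φ′Y i = linear-combination₁ 1#
      (solve 2 (λ x y → x := y :+ con (ℤ.+ 1) :* ((con (ℤ.+ 1) :* x :+ :- con (ℤ.+ 1) :* y) :- con (ℤ.+ 0))) refl (X i) (Y i))
      (φ-kernel {comb 1# X (- 1#) Y} (difference X₄≡Y₄) (difference-φ τ φX≡φY) (difference-φ τ′ φ′X≡φ′Y) i)
      where
      difference : ∀ {x y} → x ≡ y → 1# * x + - 1# * y ≡ 0#
      difference {y = y} refl = solve 1 (λ y → con (ℤ.+ 1) :* y :+ :- con (ℤ.+ 1) :* y := con (ℤ.+ 0)) refl y
      difference-φ : ∀ t → φ t X ≡ φ t Y → φ t (comb 1# X (- 1#) Y) ≡ 0₂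
      difference-φ t e = ≡.trans (φ-comb t 1# X (- 1#) Y) (≡.trans (cong (λ v → 1# ⊛ v ⊞ - 1# ⊛ φ t Y) e)
        (×-≡,≡→≡ (difference refl , difference refl)))

    φ-zero : ∀ t {X} → (∀ i → X i ≡ 0#) → φ t X ≡ 0₂
    φ-zero t X≡0 = ≡.trans (φ-cong t X≡0) (×-≡,≡→≡ (vanish , vanish))
      where
      vanish : 0# + 0# * t ≡ 0#
      vanish = solve 1 (λ t → con (ℤ.+ 0) :+ con (ℤ.+ 0) :* t := con (ℤ.+ 0)) refl t

    spreadVec-coordinates : ∀ {T u} → SpreadVec τ T u →
      u c4 ≡ 0# × Σ[ l ∈ F ] φ τ u ≡ l ⊛ T × φ τ′ u ≡ frob l ⊛ frobV T
    spreadVec-coordinates {T} {u} (u∈GF[q] , u₄≡0 , l , e₀ , e₁) = u₄≡0 , l , φu≡lT , (begin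
      φ τ′ u             ≡⟨ φ-cong τ′ (λ i → sym (u∈GF[q] i)) ⟩
      φ τ′ (conj u)      ≡⟨ φ-conj τ u ⟩
      frobV (φ τ u)      ≡⟨ cong frobV φu≡lT ⟩
      frobV (l ⊛ T)      ≡⟨ frobV-⊛ l T ⟩
      frob l ⊛ frobV T   ∎)
      where
      open ≡-Reasoning
      φu≡lT : φ τ u ≡ l ⊛ T
      φu≡lT = ×-≡,≡→≡ (e₀ , e₁)

    ExtSpreadCoordinates : V2 → V5 → Set
    ExtSpreadCoordinates T X = X c4 ≡ 0# × (Σ[ k ∈ F ] φ τ X ≡ k ⊛ T) × (Σ[ k ∈ F ] φ τ′ X ≡ k ⊛ frobV T)

    ext-spread-coordinates : ∀ {T X} → InExtSpread τ T X → ExtSpreadCoordinates T X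
    ext-spread-coordinates {T} {X} (_ , u , w , u∈ , w∈ , c , d , X≗cu+dw) =
      X₄≡0 , (c * l + d * m , collect φu φw) , (c * frob l + d * frob m , collect φ′u φ′w)
      where
      open ≡-Reasoning
      l m : F
      l = proj₁ (proj₂ (spreadVec-coordinates u∈))
      m = proj₁ (proj₂ (spreadVec-coordinates w∈))
      φu  = proj₁ (proj₂ (proj₂ (spreadVec-coordinates u∈)))
      φ′u = proj₂ (proj₂ (proj₂ (spreadVec-coordinates u∈)))
      φw  = proj₁ (proj₂ (proj₂ (spreadVec-coordinates w∈)))
      φ′w = proj₂ (proj₂ (proj₂ (spreadVec-coordinates w∈)))
      X₄≡0 : X c4 ≡ 0#
      X₄≡0 = ≡.trans (X≗cu+dw c4) (≡.trans (cong₂ (λ s t → c * s + d * t) (proj₁ (spreadVec-coordinates u∈))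
        (proj₁ (spreadVec-coordinates w∈))) (solve 2 (λ c d → c :* con (ℤ.+ 0) :+ d :* con (ℤ.+ 0) := con (ℤ.+ 0)) refl c d))
      collect : ∀ {t S a b} → φ t u ≡ a ⊛ S → φ t w ≡ b ⊛ S → φ t X ≡ (c * a + d * b) ⊛ S
      collect {t} {S} {a} {b} φu≡ φw≡ = begin
        φ t X                       ≡⟨ φ-cong t X≗cu+dw ⟩
        φ t (comb c u d w)          ≡⟨ φ-comb t c u d w ⟩
        c ⊛ φ t u ⊞ d ⊛ φ t w       ≡⟨ cong₂ (λ s v → c ⊛ s ⊞ d ⊛ v) φu≡ φw≡ ⟩
        c ⊛ (a ⊛ S) ⊞ d ⊛ (b ⊛ S)   ≡⟨ ⊛-collect c a d b S ⟩
        (c * a + d * b) ⊛ S         ∎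

    -- X is the point of [T]^★ on the transversal ker (φ t′); here {t , t′} = {τ , τ′}.
    TransversalPoint : F → F → V2 → V5 → Set
    TransversalPoint t t′ T X = X c4 ≡ 0# × (Σ[ k ∈ F ] k ≢ 0# × φ t X ≡ k ⊛ T) × φ t′ X ≡ 0₂

    transversalPoint-Same2 : ∀ {t t′ T T′ X} → Same2 T T′ → TransversalPoint t t′ T X → TransversalPoint t t′ T′ X
    transversalPoint-Same2 {T′ = T′} T~T′ (X₄≡0 , (k , k≢0 , φX≡kT) , φ′X≡0) with Same2⇒≡⊛ T~T′
    ... | l , l≢0 , refl = X₄≡0 , (k * l , *-nonzero k≢0 l≢0 , ≡.trans φX≡kT (⊛-assoc k l T′)) , φ′X≡0

    conj-transversalPoint : ∀ {t t′ T X} → frob t ≡ t′ → frob t′ ≡ t →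
                            TransversalPoint t t′ T X → TransversalPoint t′ t (frobV T) (conj X)
    conj-transversalPoint {t} {t′} {T} {X} refl t″≡t (X₄≡0 , (k , k≢0 , φX≡kT) , φ′X≡0) =
      ≡.trans (cong frob X₄≡0) frob-0 ,
      (frob k , ^-nonzero q k≢0 , ≡.trans (φ-conj t X) (≡.trans (cong frobV φX≡kT) (frobV-⊛ k T))) ,
      ≡.trans (cong (λ s → φ s (conj X)) (sym t″≡t)) (≡.trans (φ-conj t′ X) (≡.trans (cong frobV φ′X≡0) frobV-0))

    private
      zero-transfers : ∀ {x y a a′ b b′} → ¬ (x ≡ 0# × y ≡ 0#) → ¬ (a ≡ 0# × a′ ≡ 0#) →
                       x * a ≡ y * b → x * a′ ≡ y * b′ → a′ ≡ 0# → b′ ≡ 0#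
      zero-transfers {x} {y} {a} {a′} {b} {b′} xy≢0 aa′≢0 xa≡yb xa′≡yb′ a′≡0 =
        x*y≡0⇒y≡0 y≢0 (≡.trans (sym xa′≡yb′) (≡.trans (cong (x *_) a′≡0) (zeroʳ x)))
        where
        y≢0 : y ≢ 0#
        y≢0 y≡0 = aa′≢0 (x*y≡0⇒y≡0 (λ x≡0 → xy≢0 (x≡0 , y≡0)) (≡.trans xa≡yb (≡.trans (cong (_* b) y≡0) (zeroˡ b))) , a′≡0)

    -- The points of g on the extensions of the spread lines of (1,0), (0,1), (1,1) and (1,τ) have
    -- φ-coordinates forcing one of the two coefficient pairs to vanish.
    transversal-coefficients : ∀ {a a′ b b′ x₃ y₃ x₄ y₄} →
      ¬ (a ≡ 0# × a′ ≡ 0#) → ¬ (b ≡ 0# × b′ ≡ 0#) → ¬ (x₃ ≡ 0# × y₃ ≡ 0#) → ¬ (x₄ ≡ 0# × y₄ ≡ 0#) →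
      x₃ * a ≡ y₃ * b → x₃ * a′ ≡ y₃ * b′ → y₄ * b ≡ τ * (x₄ * a) → y₄ * b′ ≡ τ′ * (x₄ * a′) →
      (a′ ≡ 0# × b′ ≡ 0#) ⊎ (a ≡ 0# × b ≡ 0#)
    transversal-coefficients {a} {a′} {b} {b′} {x₃} {y₃} {x₄} {y₄} aa′≢0 bb′≢0 xy₃≢0 xy₄≢0 e₁ e₂ e₃ e₄
      with a′ ≟ 0# | a ≟ 0#
    ... | yes a′≡0 | _       = inj₁ (a′≡0 , zero-transfers xy₃≢0 aa′≢0 e₁ e₂ a′≡0)
    ... | no  _    | yes a≡0 = inj₂ (a≡0 , zero-transfers xy₃≢0 (λ (a′≡0 , a≡0) → aa′≢0 (a≡0 , a′≡0)) e₂ e₁ a≡0)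
    ... | no  a′≢0 | no a≢0  = ⊥-elim (*-nonzero (*-nonzero τ-τ′≢0 x₄≢0) (*-nonzero a≢0 a′≢0) (linear-combination₃ (- a′) a y₄
          (solve 8 (λ t t′ x₄ a a′ y₄ b b′ → (t :- t′) :* x₄ :* (a :* a′) :=
              con (ℤ.+ 0) :+ :- a′ :* (y₄ :* b :- t :* (x₄ :* a)) :+ a :* (y₄ :* b′ :- t′ :* (x₄ :* a′))
                          :+ y₄ :* ((b :* a′ :- b′ :* a) :- con (ℤ.+ 0)))
            refl τ τ′ x₄ a a′ y₄ b b′) e₃ e₄ ba′≡b′a))
      where
      τ-τ′≢0 : τ + - τ′ ≢ 0#
      τ-τ′≢0 τ-τ′≡0 = τ∉GF[q] (sym (x∙y⁻¹≈ε⇒x≈y τ τ′ τ-τ′≡0))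
      x₃≢0 : x₃ ≢ 0#
      x₃≢0 x₃≡0 = bb′≢0 (x*y≡0⇒y≡0 y₃≢0 (≡.trans (sym e₁) (≡.trans (cong (_* a) x₃≡0) (zeroˡ a))) ,
                         x*y≡0⇒y≡0 y₃≢0 (≡.trans (sym e₂) (≡.trans (cong (_* a′) x₃≡0) (zeroˡ a′))))
        where
        y₃≢0 : y₃ ≢ 0#
        y₃≢0 y₃≡0 = xy₃≢0 (x₃≡0 , y₃≡0)
      y₃≢0 : y₃ ≢ 0#
      y₃≢0 y₃≡0 = *-nonzero x₃≢0 a≢0 (≡.trans e₁ (≡.trans (cong (_* b) y₃≡0) (zeroˡ b)))
      ba′≡b′a : b * a′ + - (b′ * a) ≡ 0#
      ba′≡b′a = x*y≡0⇒y≡0 y₃≢0 (linear-combination₂ a′ (- a)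
        (solve 6 (λ y₃ x₃ a a′ b b′ → y₃ :* (b :* a′ :- b′ :* a)
                   := con (ℤ.+ 0) :+ a′ :* (y₃ :* b :- x₃ :* a) :+ :- a :* (y₃ :* b′ :- x₃ :* a′)) refl y₃ x₃ a a′ b b′)
        (sym e₁) (sym e₂))
      x₄≢0 : x₄ ≢ 0#
      x₄≢0 x₄≡0 = xy₄≢0 (x₄≡0 , ⊛-zeroˡ-nonzero bb′≢0 (×-≡,≡→≡ (vanishes e₃ , vanishes e₄)))
        where
        vanishes : ∀ {c t d} → y₄ * c ≡ t * (x₄ * d) → y₄ * c ≡ 0#
        vanishes {c} {t} {d} e = ≡.trans e (≡.trans (cong (λ x → t * (x * d)) x₄≡0) (≡.trans (cong (t *_) (zeroˡ d)) (zeroʳ t)))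

    e₁ e₂ : V2
    e₁ = 1# , 0#
    e₂ = 0# , 1#

    frob-1 : frob 1# ≡ 1#
    frob-1 = 1^n≡1 q

    frobV-e₁ : frobV e₁ ≡ e₁
    frobV-e₁ = ×-≡,≡→≡ (frob-1 , frob-0)

    frobV-e₂ : frobV e₂ ≡ e₂
    frobV-e₂ = ×-≡,≡→≡ (frob-0 , frob-1)

    φ-axes : ∀ t A B {a b} → φ t A ≡ a ⊛ e₁ → φ t B ≡ b ⊛ e₂ → ∀ x y → φ t (comb x A y B) ≡ (x * a , y * b)
    φ-axes t A B {a} {b} φA φB x y = ≡.trans (φ-comb t x A y B) (≡.trans (cong₂ (λ s v → x ⊛ s ⊞ y ⊛ v) φA φB)
      (×-≡,≡→≡ (solve 4 (λ x y a b → x :* (a :* con (ℤ.+ 1)) :+ y :* (b :* con (ℤ.+ 0)) := x :* a) refl x y a b ,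
                solve 4 (λ x y a b → x :* (a :* con (ℤ.+ 0)) :+ y :* (b :* con (ℤ.+ 1)) := y :* b) refl x y a b)))

    transversal-dichotomy : ∀ {g} → IsTransversal τ g →
      (∀ X → OnLine X g → φ τ′ X ≡ 0₂) ⊎ (∀ X → OnLine X g → φ τ X ≡ 0₂)
    transversal-dichotomy {g} g-transversal =
      dichotomy (point e₁ (λ (1≡0 , _) → 1≢0 1≡0)) (point e₂ (λ (_ , 1≡0) → 1≢0 1≡0))
                (point (1# , 1#) (λ (1≡0 , _) → 1≢0 1≡0)) (point (1# , τ) (λ (1≡0 , _) → 1≢0 1≡0))
      where
      Result : Set
      Result = (∀ X → OnLine X g → φ τ′ X ≡ 0₂) ⊎ (∀ X → OnLine X g → φ τ X ≡ 0₂)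

      PointOn : V2 → Set
      PointOn T = Σ[ P ∈ V5 ] OnLine P g × ExtSpreadCoordinates T P

      point : (T : V2) → NonZero2 T → PointOn T
      point T T≢0 = proj₁ (g-transversal T T≢0) , proj₁ (proj₂ (g-transversal T T≢0)) ,
                    ext-spread-coordinates (proj₁ (proj₂ (proj₂ (g-transversal T T≢0))))

      ratio : ∀ {p r d s t} → (p , r) ≡ d ⊛ (s , t) → s ≡ 1# → r ≡ t * p
      ratio {p} {r} {d} {s} {t} e s≡1 = begin
        r          ≡⟨ cong proj₂ e ⟩
        d * t      ≡⟨ *-comm d t ⟩
        t * d      ≡⟨ cong (t *_) (≡.trans (sym (*-identityʳ d)) (≡.trans (cong (d *_) (sym s≡1)) (sym (cong proj₁ e)))) ⟩
        t * p      ∎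
        where open ≡-Reasoning

      dichotomy : PointOn e₁ → PointOn e₂ → PointOn (1# , 1#) → PointOn (1# , τ) → Result
      dichotomy (P₁ , P₁∈g , P₁₄≡0 , (a , φP₁) , (a′ , φ′P₁)) (P₂ , P₂∈g , P₂₄≡0 , (b , φP₂) , (b′ , φ′P₂))
                (P₃ , P₃∈g , _ , (c , φP₃) , (c′ , φ′P₃)) (P₄ , P₄∈g , _ , (d , φP₄) , (d′ , φ′P₄)) =
        [ (λ (a′≡0 , b′≡0) → inj₁ (λ X X∈g → vanishes {X = X} (on-g X∈g) (φ′-coordinates (on-g X∈g)) a′≡0 b′≡0))
        , (λ (a≡0 , b≡0) → inj₂ (λ X X∈g → vanishes {X = X} (on-g X∈g) (φ-coordinates (on-g X∈g)) a≡0 b≡0)) ]′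
        (coefficient-equations (on-g P₃∈g) (on-g P₄∈g))
        where
        φ′P₁-axis : φ τ′ P₁ ≡ a′ ⊛ e₁
        φ′P₁-axis = ≡.trans φ′P₁ (cong (a′ ⊛_) frobV-e₁)
        φ′P₂-axis : φ τ′ P₂ ≡ b′ ⊛ e₂
        φ′P₂-axis = ≡.trans φ′P₂ (cong (b′ ⊛_) frobV-e₂)

        axis-nonzero : ∀ {P s s′ e} → OnLine P g → P c4 ≡ 0# → φ τ P ≡ s ⊛ e → φ τ′ P ≡ s′ ⊛ e → ¬ (s ≡ 0# × s′ ≡ 0#)
        axis-nonzero {e = e} P∈g P₄≡0 φP φ′P (refl , refl) =
          NonZero5⇒¬zero (proj₁ P∈g) (φ-kernel P₄≡0 (≡.trans φP (0⊛ e)) (≡.trans φ′P (0⊛ e)))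

        P₁⊥P₂ : Independent P₁ P₂
        P₁⊥P₂ s t st≡0 =
          ⊛-zeroˡ-nonzero (axis-nonzero P₁∈g P₁₄≡0 φP₁ φ′P₁-axis) (×-≡,≡→≡ (cong proj₁ φ≡0 , cong proj₁ φ′≡0)) ,
          ⊛-zeroˡ-nonzero (axis-nonzero P₂∈g P₂₄≡0 φP₂ φ′P₂-axis) (×-≡,≡→≡ (cong proj₂ φ≡0 , cong proj₂ φ′≡0))
          where
          zero-φ : ∀ t′ → φ t′ (comb s P₁ t P₂) ≡ 0₂
          zero-φ t′ = ≡.trans (φ-cong t′ st≡0) (×-≡,≡→≡ (solve 1 (λ t → con (ℤ.+ 0) :+ con (ℤ.+ 0) :* t := con (ℤ.+ 0)) refl t′ ,
                                                         solve 1 (λ t → con (ℤ.+ 0) :+ con (ℤ.+ 0) :* t := con (ℤ.+ 0)) refl t′))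
          φ≡0 : (s * a , t * b) ≡ 0₂
          φ≡0 = ≡.trans (sym (φ-axes τ P₁ P₂ φP₁ φP₂ s t)) (zero-φ τ)
          φ′≡0 : (s * a′ , t * b′) ≡ 0₂
          φ′≡0 = ≡.trans (sym (φ-axes τ′ P₁ P₂ φ′P₁-axis φ′P₂-axis s t)) (zero-φ τ′)

        OnG : V5 → Set
        OnG X = Σ[ x ∈ F ] Σ[ y ∈ F ] ¬ (x ≡ 0# × y ≡ 0#) × (∀ i → X i ≡ comb x P₁ y P₂ i)

        on-g : ∀ {X} → OnLine X g → OnG X
        on-g (X≢0 , X∈g) = nonzero-coefficients X≢0 (span-independent P₁⊥P₂ (proj₂ P₁∈g) (proj₂ P₂∈g) X∈g)
          where
          nonzero-coefficients : ∀ {X} → NonZero5 X → InSpan X P₁ P₂ → OnG X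
          nonzero-coefficients X≢0 (x , y , X≗) = x , y , (λ (x≡0 , y≡0) → NonZero5⇒¬zero X≢0 (λ i → ≡.trans (X≗ i)
            (≡.trans (cong₂ (λ s t → s * P₁ i + t * P₂ i) x≡0 y≡0)
              (comb-0-0 P₁ P₂ i)))) , X≗

        φ-coordinates : ∀ {X} ((x , y , _ , _) : OnG X) → φ τ X ≡ (x * a , y * b)
        φ-coordinates (x , y , _ , X≗) = ≡.trans (φ-cong τ X≗) (φ-axes τ P₁ P₂ φP₁ φP₂ x y)

        φ′-coordinates : ∀ {X} ((x , y , _ , _) : OnG X) → φ τ′ X ≡ (x * a′ , y * b′)
        φ′-coordinates (x , y , _ , X≗) = ≡.trans (φ-cong τ′ X≗) (φ-axes τ′ P₁ P₂ φ′P₁-axis φ′P₂-axis x y)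

        vanishes : ∀ {t X α β} ((x , y , _ , _) : OnG X) → φ t X ≡ (x * α , y * β) → α ≡ 0# → β ≡ 0# → φ t X ≡ 0₂
        vanishes _ φX refl refl = ≡.trans φX (×-≡,≡→≡ (zeroʳ _ , zeroʳ _))

        coefficient-equations : OnG P₃ → OnG P₄ → (a′ ≡ 0# × b′ ≡ 0#) ⊎ (a ≡ 0# × b ≡ 0#)
        coefficient-equations P₃-coords@(x₃ , y₃ , xy₃≢0 , _) P₄-coords@(x₄ , y₄ , xy₄≢0 , _) =
          transversal-coefficients (axis-nonzero P₁∈g P₁₄≡0 φP₁ φ′P₁-axis) (axis-nonzero P₂∈g P₂₄≡0 φP₂ φ′P₂-axis) xy₃≢0 xy₄≢0
            (sym (≡.trans (ratio (≡.trans (sym (φ-coordinates P₃-coords)) φP₃) refl) (*-identityˡ _)))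
            (sym (≡.trans (ratio (≡.trans (sym (φ′-coordinates P₃-coords)) φ′P₃) frob-1)
                          (≡.trans (cong (_* (x₃ * a′)) frob-1) (*-identityˡ _))))
            (ratio (≡.trans (sym (φ-coordinates P₄-coords)) φP₄) refl)
            (ratio (≡.trans (sym (φ′-coordinates P₄-coords)) φ′P₄) frob-1)

    transversal-point : ∀ {g T X} → (∀ Y → OnLine Y g → φ τ′ Y ≡ 0₂) → OnLine X g → InExtSpread τ T X →
                        TransversalPoint τ τ′ T X
    transversal-point {g} {T} {X} g⊆ker (X≢0 , X∈g) X∈[T] = point (ext-spread-coordinates X∈[T])
      where
      φ′X≡0 = g⊆ker X (X≢0 , X∈g)
      point : ExtSpreadCoordinates T X → TransversalPoint τ τ′ T X
      point (X₄≡0 , (k , φX≡kT) , _) = X₄≡0 , (k , k≢0 , φX≡kT) , φ′X≡0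
        where
        k≢0 : k ≢ 0#
        k≢0 refl = NonZero5⇒¬zero X≢0 (φ-kernel X₄≡0 (≡.trans φX≡kT (0⊛ T)) φ′X≡0)

    transversal-point′ : ∀ {g T X} → (∀ Y → OnLine Y g → φ τ Y ≡ 0₂) → OnLine X g → InExtSpread τ T X →
                         TransversalPoint τ′ τ (frobV T) X
    transversal-point′ {g} {T} {X} g⊆ker (X≢0 , X∈g) X∈[T] = point (ext-spread-coordinates X∈[T])
      where
      φX≡0 = g⊆ker X (X≢0 , X∈g)
      point : ExtSpreadCoordinates T X → TransversalPoint τ′ τ (frobV T) X
      point (X₄≡0 , _ , (k , φ′X≡kT)) = X₄≡0 , (k , k≢0 , φ′X≡kT) , φX≡0
        where
        k≢0 : k ≢ 0#
        k≢0 refl = NonZero5⇒¬zero X≢0 (φ-kernel X₄≡0 φX≡0 (≡.trans φ′X≡kT (0⊛ (frobV T))))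

    module ExtendedRegulus (b : BaerSubline) where
      open BaerSubline b
      open Basis u w det≢0

      frobV-det≢0 : proj₁ (frobV u) * proj₂ (frobV w) + - (proj₂ (frobV u) * proj₁ (frobV w)) ≢ 0#
      frobV-det≢0 = subst (_≢ 0#) frob-det (^-nonzero q det≢0)
        where
        frob-det : frob (u₀ * w₁ + - (u₁ * w₀)) ≡ frob u₀ * frob w₁ + - (frob u₁ * frob w₀)
        frob-det = ≡.trans (frob-+ _ _) (cong₂ _+_ (frob-* u₀ w₁) (≡.trans (frob-neg _) (cong -_ (frob-* u₁ w₀))))

      open Basis (frobV u) (frobV w) frobV-det≢0 public
        using () renaming (lc to lcᵠ; lc-injective to lcᵠ-injective; lc-nonzero to lcᵠ-nonzero;
                           ⊛-lc to ⊛-lcᵠ; lc-axes to lcᵠ-axes; lc-0-0 to lcᵠ-0-0)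

      frobV-lc : ∀ α β → frobV (lc α β) ≡ lcᵠ (frob α) (frob β)
      frobV-lc α β = ×-≡,≡→≡ (expand u₀ w₀ , expand u₁ w₁)
        where
        expand : ∀ a b → frob (α * a + β * b) ≡ frob α * frob a + frob β * frob b
        expand a b = ≡.trans (frob-+ _ _) (cong₂ _+_ (frob-* α a) (frob-* β b))

      -- X is the point of the line m on [lc α β]^★.
      MeetPoint : Line → F → F → Set
      MeetPoint m α β = Σ[ X ∈ V5 ] OnLine X m × X c4 ≡ 0# × Σ[ p ∈ F ] Σ[ p′ ∈ F ]
        ¬ (p ≡ 0# × p′ ≡ 0#) × φ τ X ≡ p ⊛ lc α β × φ τ′ X ≡ p′ ⊛ lcᵠ α β

      meet-point : ∀ {m α β} → InOppExtRegulus τ b m → InGFq α → InGFq β → ¬ (α ≡ 0# × β ≡ 0#) → MeetPoint m α β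
      meet-point {m} {α} {β} m-opp qα qβ αβ≢0 =
        point (m-opp (lc α β) (lc-nonzero αβ≢0) (α , β , qα , qβ , αβ≢0 , 1# , 1≢0 , sym (*-identityˡ _) , sym (*-identityˡ _)))
        where
        point : Σ[ X ∈ V5 ] OnLine X m × InExtSpread τ (lc α β) X → MeetPoint m α β
        point (X , X∈m , X∈[T]) = coordinates (ext-spread-coordinates X∈[T])
          where
          coordinates : ExtSpreadCoordinates (lc α β) X → MeetPoint m α β
          coordinates (X₄≡0 , (p , φX) , (p′ , φ′X)) =
            X , X∈m , X₄≡0 , p , p′ , pp′≢0 , φX , ≡.trans φ′X (cong (p′ ⊛_) (≡.trans (frobV-lc α β) (cong₂ lcᵠ qα qβ)))
            where
            pp′≢0 : ¬ (p ≡ 0# × p′ ≡ 0#)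
            pp′≢0 (refl , refl) = NonZero5⇒¬zero (proj₁ X∈m) (φ-kernel X₄≡0 (≡.trans φX (0⊛ _)) (≡.trans φ′X (0⊛ _)))

      regulus-line : ∀ {α β A B} → ¬ (α ≡ 0# × β ≡ 0#) →
        TransversalPoint τ τ′ (lc α β) A → TransversalPoint τ′ τ (lcᵠ α β) B → InExtRegulus τ b A B
      regulus-line {α} {β} {A} {B} αβ≢0 (A₄≡0 , (k₁ , k₁≢0 , φA) , φ′A≡0) (B₄≡0 , (k₂ , k₂≢0 , φ′B) , φB≡0) =
        A⊥B , λ m m-opp → meet m (meet-point {m} m-opp frob-1 frob-0 (λ (1≡0 , _) → 1≢0 1≡0))
                                 (meet-point {m} m-opp frob-0 frob-1 (λ (_ , 1≡0) → 1≢0 1≡0))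
                                 (meet-point {m} m-opp frob-1 frob-1 (λ (1≡0 , _) → 1≢0 1≡0))
        where
        φ-AB : ∀ c d → φ τ (comb c A d B) ≡ (c * k₁) ⊛ lc α β
        φ-AB c d = ≡.trans (φ-comb τ c A d B) (≡.trans (cong₂ (λ s v → c ⊛ s ⊞ d ⊛ v) φA φB≡0) (⊛-collectˡ c k₁ d _))

        φ′-AB : ∀ c d → φ τ′ (comb c A d B) ≡ (d * k₂) ⊛ lcᵠ α β
        φ′-AB c d = ≡.trans (φ-comb τ′ c A d B) (≡.trans (cong₂ (λ s v → c ⊛ s ⊞ d ⊛ v) φ′A≡0 φ′B) (⊛-collectʳ c d k₂ _))

        A⊥B : Independent A B
        A⊥B s t st≡0 =
          x*y≡0⇒x≡0 k₁≢0 (⊛-zeroˡ-nonzero (lc-nonzero αβ≢0) (≡.trans (sym (φ-AB s t)) (φ-zero τ st≡0))) ,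
          x*y≡0⇒x≡0 k₂≢0 (⊛-zeroˡ-nonzero (lcᵠ-nonzero αβ≢0) (≡.trans (sym (φ′-AB s t)) (φ-zero τ′ st≡0)))

        meet : ∀ m → MeetPoint m 1# 0# → MeetPoint m 0# 1# → MeetPoint m 1# 1# → Meet (line A B A⊥B) m
        meet m (Xᵤ , Xᵤ∈m , Xᵤ₄≡0 , pᵤ , pᵤ′ , pᵤ≢0 , φXᵤ , φ′Xᵤ) (Xʷ , Xʷ∈m , Xʷ₄≡0 , pʷ , pʷ′ , pʷ≢0 , φXʷ , φ′Xʷ)
               (X₁ , X₁∈m , _ , p₁ , p₁′ , _ , φX₁ , φ′X₁) =
          meeting-point (span-independent Xᵤ⊥Xʷ (proj₂ Xᵤ∈m) (proj₂ Xʷ∈m) (proj₂ X₁∈m))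
          where
          φ-uw : ∀ x y → φ τ (comb x Xᵤ y Xʷ) ≡ lc (x * pᵤ) (y * pʷ)
          φ-uw x y = ≡.trans (φ-comb τ x Xᵤ y Xʷ) (≡.trans (cong₂ (λ s v → x ⊛ s ⊞ y ⊛ v) φXᵤ φXʷ) (lc-axes x pᵤ y pʷ))

          φ′-uw : ∀ x y → φ τ′ (comb x Xᵤ y Xʷ) ≡ lcᵠ (x * pᵤ′) (y * pʷ′)
          φ′-uw x y = ≡.trans (φ-comb τ′ x Xᵤ y Xʷ) (≡.trans (cong₂ (λ s v → x ⊛ s ⊞ y ⊛ v) φ′Xᵤ φ′Xʷ) (lcᵠ-axes x pᵤ′ y pʷ′))

          Xᵤ⊥Xʷ : Independent Xᵤ Xʷ
          Xᵤ⊥Xʷ s t st≡0 = ⊛-zeroˡ-nonzero pᵤ≢0 (×-≡,≡→≡ (proj₁ vanish , proj₁ vanish′)) ,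
                           ⊛-zeroˡ-nonzero pʷ≢0 (×-≡,≡→≡ (proj₂ vanish , proj₂ vanish′))
            where
            vanish = lc-injective (≡.trans (sym (φ-uw s t)) (≡.trans (φ-zero τ st≡0) (sym lc-0-0)))
            vanish′ = lcᵠ-injective (≡.trans (sym (φ′-uw s t)) (≡.trans (φ-zero τ′ st≡0) (sym lcᵠ-0-0)))

          meeting-point : InSpan X₁ Xᵤ Xʷ → Meet (line A B A⊥B) m
          meeting-point (x , y , X₁≗) =
            Z , (Z≢0 , c , d , Z≗cA+dB) , (Z≢0 , comb-span (α * x) (β * y) (proj₂ Xᵤ∈m) (proj₂ Xʷ∈m))
            where
            Z : V5
            Z = comb (α * x) Xᵤ (β * y) Xʷ
            κ κ′ c d : F
            κ = x * pᵤ
            κ′ = x * pᵤ′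
            c = κ * inv k₁ k₁≢0
            d = κ′ * inv k₂ k₂≢0

            balanced = lc-injective (≡.trans (sym (φ-uw x y))
              (≡.trans (φ-cong τ (λ i → sym (X₁≗ i))) (≡.trans φX₁ (⊛-lc p₁ 1# 1#))))
            balanced′ = lcᵠ-injective (≡.trans (sym (φ′-uw x y))
              (≡.trans (φ-cong τ′ (λ i → sym (X₁≗ i))) (≡.trans φ′X₁ (⊛-lcᵠ p₁′ 1# 1#))))

            ypʷ≡κ : y * pʷ ≡ κ
            ypʷ≡κ = ≡.trans (proj₂ balanced) (sym (proj₁ balanced))
            ypʷ′≡κ′ : y * pʷ′ ≡ κ′
            ypʷ′≡κ′ = ≡.trans (proj₂ balanced′) (sym (proj₁ balanced′))

            rescale : ∀ {p r} → y * r ≡ x * p → α * x * p ≡ x * p * α × β * y * r ≡ x * p * β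
            rescale {p} {r} yr≡xp =
              solve 3 (λ α x p → α :* x :* p := x :* p :* α) refl α x p ,
              ≡.trans (solve 3 (λ β y r → β :* y :* r := y :* r :* β) refl β y r) (cong (_* β) yr≡xp)

            φZ : φ τ Z ≡ κ ⊛ lc α β
            φZ = ≡.trans (φ-uw (α * x) (β * y))
              (≡.trans (cong₂ lc (proj₁ (rescale ypʷ≡κ)) (proj₂ (rescale ypʷ≡κ))) (sym (⊛-lc κ α β)))
            φ′Z : φ τ′ Z ≡ κ′ ⊛ lcᵠ α β
            φ′Z = ≡.trans (φ′-uw (α * x) (β * y))
              (≡.trans (cong₂ lcᵠ (proj₁ (rescale ypʷ′≡κ′)) (proj₂ (rescale ypʷ′≡κ′))) (sym (⊛-lcᵠ κ′ α β)))

            cancel : ∀ l k (k≢0 : k ≢ 0#) → l * inv k k≢0 * k ≡ l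
            cancel l k k≢0 = ≡.trans (*-assoc l _ k) (≡.trans (cong (l *_) (inv*x≡1 k k≢0)) (*-identityʳ l))

            Z≗cA+dB : ∀ i → Z i ≡ comb c A d B i
            Z≗cA+dB = φ-injective (≡.trans (comb-c4 (α * x) Xᵤ (β * y) Xʷ Xᵤ₄≡0 Xʷ₄≡0) (sym (comb-c4 c A d B A₄≡0 B₄≡0)))
              (≡.trans φZ (sym (≡.trans (φ-AB c d) (cong (_⊛ lc α β) (cancel κ k₁ k₁≢0)))))
              (≡.trans φ′Z (sym (≡.trans (φ′-AB c d) (cong (_⊛ lcᵠ α β) (cancel κ′ k₂ k₂≢0)))))

            κκ′≢0 : ¬ (κ ≡ 0# × κ′ ≡ 0#)
            κκ′≢0 (κ≡0 , κ′≡0) = NonZero5⇒¬zero (proj₁ X₁∈m) (λ i → ≡.trans (X₁≗ i)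
              (≡.trans (cong₂ (λ s t → s * Xᵤ i + t * Xʷ i) x≡0 y≡0) (comb-0-0 Xᵤ Xʷ i)))
              where
              x≡0 = ⊛-zeroˡ-nonzero pᵤ≢0 (×-≡,≡→≡ (κ≡0 , κ′≡0))
              y≡0 = ⊛-zeroˡ-nonzero pʷ≢0 (×-≡,≡→≡ (≡.trans ypʷ≡κ κ≡0 , ≡.trans ypʷ′≡κ′ κ′≡0))

            Z≢0 : NonZero5 Z
            Z≢0 = ¬zero⇒NonZero5 λ Z≡0 → κκ′≢0
              ( ⊛-zeroˡ-nonzero (lc-nonzero αβ≢0) (≡.trans (sym φZ) (φ-zero τ Z≡0))
              , ⊛-zeroˡ-nonzero (lcᵠ-nonzero αβ≢0) (≡.trans (sym φ′Z) (φ-zero τ′ Z≡0)))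

  module ConjugatePoints (|K|≡q*q : order ≡ q ℕ.* q) (τ : F) (τ∉GF[q] : ¬ InGFq τ) (b : BaerSubline)
                         (c : Collineation) (baer-involution : IsBaerInvolution b c) where
    open BaerSubline b
    open Basis u w det≢0
    open BaerInvolution |K|≡q*q b c baer-involution
    open BruckBose τ τ∉GF[q] frobenius-+ frobenius-involutive public
    open ExtendedRegulus b
    open Collineation c using (σ)

    conjugate-regulus : ∀ {P̄ Q̄ A B} → NonZero2 P̄ → Same2 (σ P̄) Q̄ →
                        TransversalPoint τ τ′ P̄ A → TransversalPoint τ′ τ (frobV Q̄) B → InExtRegulus τ b A B
    conjugate-regulus {P̄} {Q̄} {A} {B} P̄≢0 σP̄~Q̄ A-point B-point =
      regulus-line (nonzero-lc (subst NonZero2 P̄≡lc P̄≢0))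
        (transversalPoint-Same2 {X = A} (≡⊛⇒Same2 1≢0 (≡.trans P̄≡lc (sym (1⊛ _)))) A-point)
        (transversalPoint-Same2 {X = B} frobV-Q̄~lcᵠ B-point)
      where
      α β : F
      α = proj₁ (lc-surjective P̄)
      β = proj₁ (proj₂ (lc-surjective P̄))
      P̄≡lc : P̄ ≡ lc α β
      P̄≡lc = proj₂ (proj₂ (lc-surjective P̄))
      Q̄~lc : Same2 Q̄ (lc (frob α) (frob β))
      Q̄~lc = Same2-trans (Same2-sym σP̄~Q̄) (≡⊛⇒Same2 ϱ≢0 (≡.trans (cong σ P̄≡lc) (σ-lc-frobenius α β)))
      frobV-Q̄~lcᵠ : Same2 (frobV Q̄) (lcᵠ α β)
      frobV-Q̄~lcᵠ = frobenius-scaled (Same2⇒≡⊛ Q̄~lc)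
        where
        frobenius-scaled : Σ[ l ∈ F ] l ≢ 0# × Q̄ ≡ l ⊛ lc (frob α) (frob β) → Same2 (frobV Q̄) (lcᵠ α β)
        frobenius-scaled (l , l≢0 , Q̄≡) = ≡⊛⇒Same2 (^-nonzero q l≢0) (begin
          frobV Q̄                                      ≡⟨ cong frobV Q̄≡ ⟩
          frobV (l ⊛ lc (frob α) (frob β))             ≡⟨ frobV-⊛ l _ ⟩
          frob l ⊛ frobV (lc (frob α) (frob β))        ≡⟨ cong (frob l ⊛_) (frobV-lc (frob α) (frob β)) ⟩
          frob l ⊛ lcᵠ (frob (frob α)) (frob (frob β)) ≡⟨ cong₂ (λ s t → frob l ⊛ lcᵠ s t) (frobenius-involutive α)
                                                                                          (frobenius-involutive β) ⟩
          frob l ⊛ lcᵠ α β                             ∎)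
          where open ≡-Reasoning

    conj-transversalPoint′ : ∀ {T X} → TransversalPoint τ′ τ (frobV T) X → TransversalPoint τ τ′ T (conj X)
    conj-transversalPoint′ {T} {X} X-point = subst (λ S → TransversalPoint τ τ′ S (conj X)) (frobV-involutive T)
      (conj-transversalPoint {X = X} (frobenius-involutive τ) refl X-point)

    conjugate-lines-in-regulus : ∀ {g P̄ Q̄ P Q} → (∀ X → OnLine X g → φ τ′ X ≡ 0₂) →
      NonZero2 P̄ → NonZero2 Q̄ → Same2 (σ P̄) Q̄ → Same2 (σ Q̄) P̄ →
      OnLine P g → InExtSpread τ P̄ P → OnLine Q g → InExtSpread τ Q̄ Q →
      InExtRegulus τ b P (conj Q) × InExtRegulus τ b (conj P) Q
    conjugate-lines-in-regulus {g} {P̄} {Q̄} {P} {Q} g⊆ker P̄≢0 Q̄≢0 σP̄~Q̄ σQ̄~P̄ P∈g P∈[P̄] Q∈g Q∈[Q̄] =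
      conjugate-regulus {A = P} {B = conj Q} P̄≢0 σP̄~Q̄ P-point
        (conj-transversalPoint {X = Q} refl (frobenius-involutive τ) Q-point) ,
      InExtRegulus-sym {t = τ} {b = b} {A = Q} {B = conj P} (conjugate-regulus {A = Q} {B = conj P} Q̄≢0 σQ̄~P̄ Q-point
        (conj-transversalPoint {X = P} refl (frobenius-involutive τ) P-point))
      where
      P-point : TransversalPoint τ τ′ P̄ P
      P-point = transversal-point {g = g} {T = P̄} {X = P} g⊆ker P∈g P∈[P̄]
      Q-point : TransversalPoint τ τ′ Q̄ Q
      Q-point = transversal-point {g = g} {T = Q̄} {X = Q} g⊆ker Q∈g Q∈[Q̄]

    conjugate-lines-in-regulus′ : ∀ {g P̄ Q̄ P Q} → (∀ X → OnLine X g → φ τ X ≡ 0₂) →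
      NonZero2 P̄ → NonZero2 Q̄ → Same2 (σ P̄) Q̄ → Same2 (σ Q̄) P̄ →
      OnLine P g → InExtSpread τ P̄ P → OnLine Q g → InExtSpread τ Q̄ Q →
      InExtRegulus τ b P (conj Q) × InExtRegulus τ b (conj P) Q
    conjugate-lines-in-regulus′ {g} {P̄} {Q̄} {P} {Q} g⊆ker P̄≢0 Q̄≢0 σP̄~Q̄ σQ̄~P̄ P∈g P∈[P̄] Q∈g Q∈[Q̄] =
      InExtRegulus-sym {t = τ} {b = b} {A = conj Q} {B = P}
        (conjugate-regulus {A = conj Q} {B = P} Q̄≢0 σQ̄~P̄ (conj-transversalPoint′ {X = Q} Q-point) P-point) ,
      conjugate-regulus {A = conj P} {B = Q} P̄≢0 σP̄~Q̄ (conj-transversalPoint′ {X = P} P-point) Q-point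
      where
      P-point : TransversalPoint τ′ τ (frobV P̄) P
      P-point = transversal-point′ {g = g} {T = P̄} {X = P} g⊆ker P∈g P∈[P̄]
      Q-point : TransversalPoint τ′ τ (frobV Q̄) Q
      Q-point = transversal-point′ {g = g} {T = Q̄} {X = Q} g⊆ker Q∈g Q∈[Q̄]

theorem3p2 : (K : FiniteField) (q : ℕ) → FiniteField.order K ≡ q ℕ.* q →
    let open Geom K q in
    (τ : F) → ¬ InGFq τ →
    (g : Line) → IsTransversal τ g →
    (b : BaerSubline) (P̄ Q̄ : V2) → NonZero2 P̄ → NonZero2 Q̄ → Conjugate b P̄ Q̄ →
    (P Q : V5) → OnLine P g → InExtSpread τ P̄ P → OnLine Q g → InExtSpread τ Q̄ Q →
    InExtRegulus τ b P (conj Q) × InExtRegulus τ b (conj P) Q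
theorem3p2 K q |K|≡q*q τ τ∉GF[q] g g-transversal b P̄ Q̄ P̄≢0 Q̄≢0 (c , baer-involution , σP̄~Q̄ , σQ̄~P̄)
           P Q P∈g P∈[P̄] Q∈g Q∈[Q̄] =
  [ (λ g⊆ker-φτ′ → conjugate-lines-in-regulus {g} {P̄} {Q̄} {P} {Q} g⊆ker-φτ′ P̄≢0 Q̄≢0 σP̄~Q̄ σQ̄~P̄ P∈g P∈[P̄] Q∈g Q∈[Q̄])
  , (λ g⊆ker-φτ → conjugate-lines-in-regulus′ {g} {P̄} {Q̄} {P} {Q} g⊆ker-φτ P̄≢0 Q̄≢0 σP̄~Q̄ σQ̄~P̄ P∈g P∈[P̄] Q∈g Q∈[Q̄])
  ]′ (transversal-dichotomy {g} g-transversal)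
  where open ConjugatePoints K q |K|≡q*q τ τ∉GF[q] b c baer-involution
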